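{- Fix an integer $k\ge 1$. When only one piece size, $k$, is used and all interfaces are allowed, the number of half-pyramids with $n\ge1$ pieces equals $\dfrac{(kn)!}{n!\,(kn-n+1)!}$, and the number of pyramids with $n\ge 1$ pieces equals $\dfrac{1}{k}\dbinom{kn}{n}$.
   Context: A $k$-mer is a $1\times k$ rectangular piece; on a given floor (row) it occupies an integer interval $[a,a+k]$, $a\in\mathbb{Z}$. A tower (of $k$-mers) is a finite sequence of nonempty floors $F_1,\dots,F_h$, each a finite set of $k$-mers with pairwise disjoint interiors, such that the bottom floor $F_1$ consists of one or more pieces placed contiguously (no gaps), and every piece of $F_{j+1}$ intersects some piece of $F_j$ in an interval of strictly positive length (all such interfaces allowed, including exact alignment). Towers are considered up to horizontal translation. A pyramid is a tower whose bottom floor has exactly one piece; a half-pyramid is a pyramid in which no piece has its left endpoint strictly to the left of the left endpoint of the bottom piece. -}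

module Defs where

open import Data.Nat as ℕ using (ℕ; zero; suc; _∸_; _!; _/_)
open import Data.Nat.Properties using (_!*_!≢0)
open import Data.Nat.Combinatorics using (_C_)
open import Data.Integer as ℤ using (ℤ; +_; _+_; _-_; _≤?_; _<?_)
open import Data.Bool using (Bool; true; false; _∧_; _∨_; not; T)
open import Data.List using (List; []; _∷_; length; map)
open import Data.Bool.ListAction using (all; any)
open import Data.Nat.ListAction using (sum)
open import Data.Product using (Σ)
open import Relation.Nullary.Decidable using (⌊_⌋)

-- A k-mer on a floor occupying [a, a+k] is recorded by its left
-- endpoint a : ℤ.  A floor (finite set of k-mers with pairwise disjoint
-- interiors) is recorded canonically as the strictly increasing list of
-- left endpoints; disjointness of interiors of consecutive pieces is
-- a + k ≤ b.  A tower F₁,…,F_h is the list [F₁, …, F_h] (bottom first).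

Floor : Set
Floor = List ℤ

Tower : Set
Tower = List Floor

disjointFloor : ℕ → Floor → Bool
disjointFloor k []            = true
disjointFloor k (a ∷ [])      = true
disjointFloor k (a ∷ b ∷ bs)  = ⌊ a + + k ≤? b ⌋ ∧ disjointFloor k (b ∷ bs)

contiguousFloor : ℕ → Floor → Bool
contiguousFloor k []           = true
contiguousFloor k (a ∷ [])     = true
contiguousFloor k (a ∷ b ∷ bs) =
  ⌊ a + + k ≤? b ⌋ ∧ ⌊ b ≤? a + + k ⌋ ∧ contiguousFloor k (b ∷ bs)

nonempty : Floor → Bool
nonempty []      = false
nonempty (_ ∷ _) = true

-- [b, b+k] and [a, a+k] intersect in an interval of positive length
-- iff a - k < b < a + k
overlaps : ℕ → ℤ → ℤ → Bool
overlaps k b a = ⌊ a - + k <? b ⌋ ∧ ⌊ b <? a + + k ⌋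

supported : ℕ → Floor → Floor → Bool
supported k upper lower = all (λ b → any (overlaps k b) lower) upper

upperFloorsOK : ℕ → Floor → List Floor → Bool
upperFloorsOK k lower []       = true
upperFloorsOK k lower (F ∷ Fs) =
  nonempty F ∧ disjointFloor k F ∧ supported k F lower ∧ upperFloorsOK k F Fs

-- a tower of k-mers, normalised (to fix horizontal translation) so that
-- the leftmost piece of the bottom floor has left endpoint 0
isTower : ℕ → Tower → Bool
isTower k []             = false
isTower k ([] ∷ Fs)      = false
isTower k ((a ∷ as) ∷ Fs) =
  ⌊ a ℤ.≟ + 0 ⌋ ∧ contiguousFloor k (a ∷ as) ∧ disjointFloor k (a ∷ as)
    ∧ upperFloorsOK k (a ∷ as) Fs

isPyramid : ℕ → Tower → Bool
isPyramid k []       = false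
isPyramid k (F ∷ Fs) = isTower k (F ∷ Fs) ∧ ⌊ length F ℕ.≟ 1 ⌋

-- half-pyramid: pyramid in which no left endpoint is strictly left of the
-- left endpoint of the bottom piece (which is 0 after normalisation)
isHalfPyramid : ℕ → Tower → Bool
isHalfPyramid k t =
  isPyramid k t ∧ all (λ F → all (λ a → ⌊ + 0 ≤? a ⌋) F) t

pieces : Tower → ℕ
pieces t = sum (map length t)

-- The types of (translation classes of) pyramids / half-pyramids of
-- k-mers with n pieces.  T of a Bool is proof-irrelevant, so elements
-- correspond exactly to towers.
Pyramid : ℕ → ℕ → Set
Pyramid k n = Σ Tower (λ t → T (isPyramid k t ∧ ⌊ pieces t ℕ.≟ n ⌋))

HalfPyramid : ℕ → ℕ → Set
HalfPyramid k n = Σ Tower (λ t → T (isHalfPyramid k t ∧ ⌊ pieces t ℕ.≟ n ⌋))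

halfPyramidCount : ℕ → ℕ → ℕ
halfPyramidCount k n =
  _/_ ((k ℕ.* n) !) (n ! ℕ.* (k ℕ.* n ∸ n ℕ.+ 1) !) {{ n !* (k ℕ.* n ∸ n ℕ.+ 1) !≢0 }}

pyramidCount : (k : ℕ) → .{{ ℕ.NonZero k }} → ℕ → ℕ
pyramidCount k n = ((k ℕ.* n) C n) / k

module Submission where

-- Pyramids and half-pyramids of k-mers are counted with generating trees.
-- Every pyramid with n ≥ 2 pieces arises from a unique pyramid with n - 1
-- pieces by dropping one new piece from above, namely its leftmost maximal
-- piece (a piece nothing rests on); removing that piece (removeLM) inverts
-- the drop (dropPiece).  Which drop positions are admissible depends only
-- on a numeric label of the pyramid (the distance from its left edge to its
-- leftmost maximal piece), and so does the label of each child; likewise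
-- for half-pyramids with the position of the leftmost maximal piece.

open import Defs
open import Data.Nat using (ℕ; suc; NonZero; _≥_)
open import Data.Fin using (Fin)
open import Data.Product using (_×_; _,_)
open import Function.Bundles using (_↔_)
open import Function.Properties.Inverse using (↔-trans)

module BooleanReflection where
  open import Data.Bool using (true; false; T; _∧_; _∨_)
  open import Data.Bool.Properties using (T-∧; T-∨)
  open import Data.Empty using (⊥-elim)
  open import Data.Product using (_,_; proj₁; proj₂)
  open import Data.Sum using (_⊎_; inj₁; inj₂)
  open import Function.Bundles using (Equivalence)
  open import Relation.Nullary using (¬_)
  open import Relation.Binary.PropositionalEquality using (_≡_; refl)

  ∧-intro : ∀ {x y} → T x → T y → T (x ∧ y)
  ∧-intro a b = Equivalence.from T-∧ (a , b)

  ∧-fst : ∀ {x y} → T (x ∧ y) → T x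
  ∧-fst {x} h = proj₁ (Equivalence.to (T-∧ {x}) h)

  ∧-snd : ∀ {x y} → T (x ∧ y) → T y
  ∧-snd {x} h = proj₂ (Equivalence.to (T-∧ {x}) h)

  ∨-elim : ∀ {x y} → T (x ∨ y) → T x ⊎ T y
  ∨-elim {x} = Equivalence.to (T-∨ {x})

  ∨-inl : ∀ {x y} → T x → T (x ∨ y)
  ∨-inl {x} a = Equivalence.from (T-∨ {x}) (inj₁ a)

  ∨-inr : ∀ {x y} → T y → T (x ∨ y)
  ∨-inr {x} b = Equivalence.from (T-∨ {x}) (inj₂ b)

  false⇒¬T : ∀ {b} → b ≡ false → ¬ T b
  false⇒¬T refl ()

  ¬T⇒false : ∀ {b} → ¬ T b → b ≡ false
  ¬T⇒false {true}  f = ⊥-elim (f _)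
  ¬T⇒false {false} f = refl

  T⇒true : ∀ {b} → T b → b ≡ true
  T⇒true {true} _ = refl

  true⇒T : ∀ {b} → b ≡ true → T b
  true⇒T refl = _

module FiniteSums where
  open import Data.Nat using (ℕ; zero; suc; _+_; _*_; _<_; z<s; s<s)
  open import Data.Nat.Properties using (+-assoc; *-zeroʳ; *-distribˡ-+)
  open import Data.Nat.Tactic.RingSolver using (solve-∀)
  open import Data.Fin using (Fin; zero; suc; toℕ)
  open import Data.Fin.Properties using (+↔⊎)
  open import Data.Product using (Σ; _,_)
  open import Data.Sum using (_⊎_; inj₁; inj₂)
  open import Data.Sum.Function.Propositional using (_⊎-↔_)
  open import Function using (_∘_)
  open import Function.Bundles using (_↔_; mk↔ₛ′)
  open import Function.Properties.Inverse using (↔-refl; ↔-sym; ↔-trans)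
  open import Relation.Binary.PropositionalEquality using (_≡_; refl; sym; cong; cong₂)

  sumBelow : ℕ → (ℕ → ℕ) → ℕ
  sumBelow zero    f = 0
  sumBelow (suc n) f = f 0 + sumBelow n (f ∘ suc)

  Fin-cong : ∀ {m n} → m ≡ n → Fin m ↔ Fin n
  Fin-cong refl = ↔-refl

  Σ-Fin↔Fin-sumBelow : ∀ n (f : ℕ → ℕ) → Σ (Fin n) (Fin ∘ f ∘ toℕ) ↔ Fin (sumBelow n f)
  Σ-Fin↔Fin-sumBelow zero    f = mk↔ₛ′ (λ { (() , _) }) (λ ()) (λ ()) (λ { (() , _) })
  Σ-Fin↔Fin-sumBelow (suc n) f =
    ↔-trans split (↔-trans (↔-refl ⊎-↔ Σ-Fin↔Fin-sumBelow n (f ∘ suc)) (↔-sym +↔⊎))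
    where
    B : Fin (suc n) → Set
    B = Fin ∘ f ∘ toℕ
    split : Σ (Fin (suc n)) B ↔ (B zero ⊎ Σ (Fin n) (B ∘ suc))
    split = mk↔ₛ′ to from (λ { (inj₁ _) → refl ; (inj₂ _) → refl })
                          (λ { (zero , _) → refl ; (suc _ , _) → refl })
      where
      to : Σ (Fin (suc n)) B → B zero ⊎ Σ (Fin n) (B ∘ suc)
      to (zero  , b) = inj₁ b
      to (suc i , b) = inj₂ (i , b)
      from : B zero ⊎ Σ (Fin n) (B ∘ suc) → Σ (Fin (suc n)) B
      from (inj₁ b)       = zero , b
      from (inj₂ (i , b)) = suc i , b

  sumBelow-cong : ∀ n {f g : ℕ → ℕ} → (∀ i → i < n → f i ≡ g i) → sumBelow n f ≡ sumBelow n g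
  sumBelow-cong zero    eq = refl
  sumBelow-cong (suc n) eq = cong₂ _+_ (eq 0 z<s) (sumBelow-cong n (λ i i<n → eq (suc i) (s<s i<n)))

  sumBelow-+ : ∀ n (f g : ℕ → ℕ) → sumBelow n (λ i → f i + g i) ≡ sumBelow n f + sumBelow n g
  sumBelow-+ zero    f g = refl
  sumBelow-+ (suc n) f g rewrite sumBelow-+ n (f ∘ suc) (g ∘ suc) =
    interchange (f 0) (g 0) (sumBelow n (f ∘ suc)) (sumBelow n (g ∘ suc))
    where
    interchange : ∀ a b c d → a + b + (c + d) ≡ a + c + (b + d)
    interchange = solve-∀

  sumBelow-* : ∀ n c (f : ℕ → ℕ) → sumBelow n (λ i → c * f i) ≡ c * sumBelow n f
  sumBelow-* zero    c f = sym (*-zeroʳ c)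
  sumBelow-* (suc n) c f rewrite sumBelow-* n c (f ∘ suc) = sym (*-distribˡ-+ c (f 0) _)

  sumBelow-split : ∀ a b (f : ℕ → ℕ) → sumBelow (a + b) f ≡ sumBelow a f + sumBelow b (λ i → f (a + i))
  sumBelow-split zero    b f = refl
  sumBelow-split (suc a) b f rewrite sumBelow-split a b (f ∘ suc) = sym (+-assoc (f 0) _ _)

  sumBelow-const : ∀ n c → sumBelow n (λ _ → c) ≡ n * c
  sumBelow-const zero    c = refl
  sumBelow-const (suc n) c = cong (c +_) (sumBelow-const n c)

module GeneratingTrees where
  open import Data.Nat as ℕ using (ℕ; zero; suc; _+_; _<_; _≤_; s≤s; z≤n)
  open import Data.Nat.Properties as ℕP using (+-suc)
  open import Data.Fin using (Fin; zero; toℕ; fromℕ<)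
  open import Data.Fin.Properties using (toℕ-fromℕ<; toℕ-injective; toℕ<n)
  open import Data.Bool using (Bool; T; _∧_)
  open import Data.Bool.Properties using (T-irrelevant)
  open import Data.Unit using (⊤; tt)
  open import Data.Product using (Σ; _×_; _,_; proj₁; proj₂)
  open import Data.Product.Function.Dependent.Propositional using (Σ-↔)
  open import Function using (_∘_)
  open import Function.Bundles using (_↔_; mk↔ₛ′)
  open import Function.Properties.Inverse using (↔-refl; ↔-trans)
  open import Relation.Nullary.Decidable using (⌊_⌋; toWitness; fromWitness)
  open import Relation.Binary.PropositionalEquality
  open import Relation.Binary.PropositionalEquality.WithK using (≡-irrelevant)
  open BooleanReflection using (∧-intro; ∧-fst; ∧-snd)
  open FiniteSums

  -- The number of paths of length m down a tree in which a node labelled u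
  -- has arity u children, the i-th of them labelled childLabel u i.
  treeCount : (arity : ℕ → ℕ) (childLabel : ℕ → ℕ → ℕ) → ℕ → ℕ → ℕ
  treeCount arity childLabel zero    u = 1
  treeCount arity childLabel (suc m) u =
    sumBelow (arity u) (treeCount arity childLabel m ∘ childLabel u)

  -- Suppose the valid nodes are organised
  -- as a rooted tree by size: the root is the only valid node of size 1,
  -- every valid node of size ≥ 2 has a valid parent of which it is a child,
  -- and a valid node with label u has exactly the children with indices
  -- i < arity u, each one size larger and labelled childLabel u i.  Then
  -- the valid nodes of size m + 1 are in bijection with the paths of length
  -- m down from the root, so there are treeCount arity childLabel m
  -- (label root) of them.
  module GeneratingTree
    {Node : Set}
    (valid : Node → Bool)
    (size : Node → ℕ)
    (label : Node → ℕ)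
    (arity : ℕ → ℕ)
    (childLabel : ℕ → ℕ → ℕ)
    (child : Node → ℕ → Node)
    (parent : Node → Node)
    (childIndex : Node → ℕ)
    (root : Node)
    (root-valid : T (valid root))
    (root-size : size root ≡ 1)
    (root-unique : ∀ t → T (valid t) → size t ≡ 1 → t ≡ root)
    (size-positive : ∀ t → T (valid t) → 0 < size t)
    (child-spec : ∀ t i → T (valid t) → i < arity (label t) →
        T (valid (child t i)) × parent (child t i) ≡ t × size (child t i) ≡ suc (size t)
          × childIndex (child t i) ≡ i × label (child t i) ≡ childLabel (label t) i)
    (parent-spec : ∀ s → T (valid s) → 1 < size s →
        T (valid (parent s)) × childIndex s < arity (label (parent s))
          × child (parent s) (childIndex s) ≡ s)
    where

    count : ℕ → ℕ → ℕ
    count = treeCount arity childLabel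

    ancestor : ℕ → Node → Node
    ancestor zero    s = s
    ancestor (suc m) s = ancestor m (parent s)

    ancestor-suc : ∀ m s → ancestor (suc m) s ≡ parent (ancestor m s)
    ancestor-suc zero    s = refl
    ancestor-suc (suc m) s = ancestor-suc m (parent s)

    ancestor-valid : ∀ m c s → T (valid s) → size s ≡ m + suc c →
                     T (valid (ancestor m s)) × size (ancestor m s) ≡ suc c
    ancestor-valid zero    c s v e = v , e
    ancestor-valid (suc m) c s v e =
      ancestor-valid m c (parent s) (proj₁ spec) (ℕP.suc-injective size-parent)
      where
      big : 1 < size s
      big = subst (1 <_) (sym e) (s≤s (subst (1 ≤_) (sym (+-suc m c)) (s≤s z≤n)))
      spec = parent-spec s v big
      size-parent : suc (size (parent s)) ≡ suc (m + suc c)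
      size-parent = begin
        suc (size (parent s))                   ≡˘⟨ size-child ⟩
        size (child (parent s) (childIndex s))  ≡⟨ cong size (proj₂ (proj₂ spec)) ⟩
        size s                                  ≡⟨ e ⟩
        suc (m + suc c)                         ∎
        where
        open ≡-Reasoning
        size-child = proj₁ (proj₂ (proj₂ (child-spec (parent s) _ (proj₁ spec) (proj₁ (proj₂ spec)))))

    Descendant : Node → ℕ → Set
    Descendant t m = Σ Node λ s → T (valid s) × size s ≡ m + size t × ancestor m s ≡ t

    Path : Node → ℕ → Set
    Path t zero    = ⊤
    Path t (suc m) = Σ (Fin (arity (label t))) λ i → Path (child t (toℕ i)) m

    Descendant-≡ : ∀ {t m} {a b : Descendant t m} → proj₁ a ≡ proj₁ b → a ≡ b
    Descendant-≡ {a = s , v , p , q} {.s , v′ , p′ , q′} refl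
      rewrite T-irrelevant v v′ | ≡-irrelevant p p′ | ≡-irrelevant q q′ = refl

    child-valid : ∀ t (i : Fin (arity (label t))) → T (valid t) → T (valid (child t (toℕ i)))
    child-valid t i v = proj₁ (child-spec t (toℕ i) v (toℕ<n i))

    -- A descendant m + 1 generations below t is a child of t followed by a
    -- descendant m generations below that child.
    module FirstStep (t : Node) (vt : T (valid t)) (m : ℕ) where

      Tail : Fin (arity (label t)) → Set
      Tail i = Descendant (child t (toℕ i)) m

      to : Descendant t (suc m) → Σ (Fin (arity (label t))) Tail
      to (s , v , size-s , anc) = fromℕ< index<arity , s , v , size-s′ , anc′
        where
        s′ = ancestor m s
        climb = ancestor-valid m (size t) s v (trans size-s (sym (+-suc m (size t))))
        spec = parent-spec s′ (proj₁ climb)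
                 (subst (1 <_) (sym (proj₂ climb)) (s≤s (size-positive t vt)))
        parent-s′ : parent s′ ≡ t
        parent-s′ = trans (sym (ancestor-suc m s)) anc
        index<arity : childIndex s′ < arity (label t)
        index<arity = subst (λ x → childIndex s′ < arity (label x)) parent-s′ (proj₁ (proj₂ spec))
        child-s′ : child t (childIndex s′) ≡ s′
        child-s′ = trans (cong (λ x → child x (childIndex s′)) (sym parent-s′)) (proj₂ (proj₂ spec))
        size-s′ : size s ≡ m + size (child t (toℕ (fromℕ< index<arity)))
        size-s′ rewrite toℕ-fromℕ< index<arity | child-s′ | proj₂ climb =
          trans size-s (sym (+-suc m (size t)))
        anc′ : ancestor m s ≡ child t (toℕ (fromℕ< index<arity))
        anc′ rewrite toℕ-fromℕ< index<arity = sym child-s′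

      from : Σ (Fin (arity (label t))) Tail → Descendant t (suc m)
      from (i , s , v , size-s , anc) = s , v , size-s′ , anc′
        where
        spec = child-spec t (toℕ i) vt (toℕ<n i)
        size-s′ : size s ≡ suc m + size t
        size-s′ = trans size-s (trans (cong (m +_) (proj₁ (proj₂ (proj₂ spec)))) (+-suc m (size t)))
        anc′ : ancestor (suc m) s ≡ t
        anc′ = trans (ancestor-suc m s) (trans (cong parent anc) (proj₁ (proj₂ spec)))

      from-to : ∀ a → from (to a) ≡ a
      from-to a = Descendant-≡ refl

      pair-≡ : ∀ {i i′} (e : i ≡ i′) {a : Tail i} {a′ : Tail i′} → proj₁ a ≡ proj₁ a′ →
               (i , a) ≡ (i′ , a′)
      pair-≡ {i} refl {a} {a′} e = cong (i ,_) (Descendant-≡ {child t (toℕ i)} {m} {a} {a′} e)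

      to-from : ∀ b → to (from b) ≡ b
      to-from (i , s , v , size-s , anc) = pair-≡ (toℕ-injective (trans (toℕ-fromℕ< _) index-s)) refl
        where
        index-s : childIndex (ancestor m s) ≡ toℕ i
        index-s = trans (cong childIndex anc)
                        (proj₁ (proj₂ (proj₂ (proj₂ (child-spec t (toℕ i) vt (toℕ<n i))))))

      split : Descendant t (suc m) ↔ Σ (Fin (arity (label t))) Tail
      split = mk↔ₛ′ to from to-from from-to

    Descendant↔Path : ∀ m t → T (valid t) → Descendant t m ↔ Path t m
    Descendant↔Path zero t v = mk↔ₛ′ (λ _ → tt) (λ _ → t , v , refl , refl) (λ _ → refl) self
      where
      self : ∀ a → (t , v , refl , refl) ≡ a
      self (s , v′ , p , refl) = Descendant-≡ refl
    Descendant↔Path (suc m) t v =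
      ↔-trans (FirstStep.split t v m) (Σ-↔ ↔-refl (Descendant↔Path m _ (child-valid t _ v)))

    Path↔Fin : ∀ m t → T (valid t) → Path t m ↔ Fin (count m (label t))
    Path↔Fin zero t v = mk↔ₛ′ (λ _ → zero) (λ _ → tt) (λ { zero → refl }) (λ _ → refl)
    Path↔Fin (suc m) t v =
      ↔-trans (Σ-↔ ↔-refl (↔-trans (Path↔Fin m _ (child-valid t _ v)) (Fin-cong (cong (count m) label-child))))
              (Σ-Fin↔Fin-sumBelow (arity (label t)) (count m ∘ childLabel (label t)))
      where
      label-child : ∀ {i} → label (child t (toℕ i)) ≡ childLabel (label t) (toℕ i)
      label-child {i} = proj₂ (proj₂ (proj₂ (proj₂ (child-spec t (toℕ i) v (toℕ<n i)))))

    sized↔Descendant : ∀ m → Σ Node (λ s → T (valid s ∧ ⌊ size s ℕ.≟ suc m ⌋)) ↔ Descendant root m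
    sized↔Descendant m =
      mk↔ₛ′ to from (λ a → Descendant-≡ refl) (λ { (s , h) → cong (s ,_) (T-irrelevant _ _) })
      where
      size-eq : ∀ {s} → size s ≡ suc m → size s ≡ m + size root
      size-eq e = trans e (trans (ℕP.+-comm 1 m) (cong (m +_) (sym root-size)))
      to : Σ Node (λ s → T (valid s ∧ ⌊ size s ℕ.≟ suc m ⌋)) → Descendant root m
      to (s , h) = s , v , size-eq e , root-unique _ (proj₁ climb) (proj₂ climb)
        where
        v = ∧-fst {valid s} h
        e = toWitness (∧-snd {valid s} h)
        climb = ancestor-valid m 0 s v (trans e (ℕP.+-comm 1 m))
      from : Descendant root m → Σ Node (λ s → T (valid s ∧ ⌊ size s ℕ.≟ suc m ⌋))
      from (s , v , e , _) =
        s , ∧-intro {valid s} v (fromWitness (trans e (trans (cong (m +_) root-size) (ℕP.+-comm m 1))))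

    sized↔Fin : ∀ m → Σ Node (λ s → T (valid s ∧ ⌊ size s ℕ.≟ suc m ⌋)) ↔ Fin (count m (label root))
    sized↔Fin m = ↔-trans (sized↔Descendant m)
                          (↔-trans (Descendant↔Path m root root-valid) (Path↔Fin m root root-valid))


module Binomials where
  open import Data.Nat
  open import Data.Nat.Properties
  open import Data.Nat.Combinatorics using (_C_; nC1≡n; k>n⇒nCk≡0; nCk≡n!/k![n-k]!; k![n∸k]!∣n!;
    nCk+nC[k+1]≡[n+1]C[k+1])
  open import Data.Nat.DivMod using (m/n*n≡m)
  open import Data.Nat.Tactic.RingSolver using (solve-∀)
  open import Relation.Binary.PropositionalEquality
  open FiniteSums

  pascal : ∀ n m → n C m + n C suc m ≡ suc n C suc m
  pascal = nCk+nC[k+1]≡[n+1]C[k+1]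

  absorption : ∀ N m → suc m * (suc N C suc m) ≡ suc N * (N C m)
  absorption zero zero = refl
  absorption zero (suc m)
    rewrite k>n⇒nCk≡0 {1} {suc (suc m)} (s<s z<s) | k>n⇒nCk≡0 {0} {suc m} z<s = *-zeroʳ (suc (suc m))
  absorption (suc N) zero rewrite nC1≡n (suc (suc N)) = *-comm 1 (suc (suc N))
  absorption (suc N) (suc m) = begin
    suc (suc m) * (suc (suc N) C suc (suc m))     ≡⟨ cong (suc (suc m) *_) (sym (pascal (suc N) (suc m))) ⟩
    suc (suc m) * (a + b)                         ≡⟨ regroup m a b ⟩
    a + (suc m * a + suc (suc m) * b)
      ≡⟨ cong₂ (λ x y → a + (x + y)) (absorption N m) (absorption N (suc m)) ⟩
    a + (suc N * c + suc N * d)                   ≡⟨ cong (a +_) (sym (*-distribˡ-+ (suc N) c d)) ⟩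
    a + suc N * (c + d)                           ≡⟨ cong (λ x → a + suc N * x) (pascal N m) ⟩
    suc (suc N) * a                               ∎
    where
    open ≡-Reasoning
    a = suc N C suc m
    b = suc N C suc (suc m)
    c = N C m
    d = N C suc m
    regroup : ∀ m a b → suc (suc m) * (a + b) ≡ a + (suc m * a + suc (suc m) * b)
    regroup = solve-∀

  hockeyStick : ∀ a m T → a C suc m + sumBelow T (λ i → (a + i) C m) ≡ (a + T) C suc m
  hockeyStick a m zero = trans (+-identityʳ (a C suc m)) (cong (_C suc m) (sym (+-identityʳ a)))
  hockeyStick a m (suc T) = begin
    a C suc m + ((a + 0) C m + rest a)            ≡⟨ cong (λ x → a C suc m + (x C m + rest a)) (+-identityʳ a) ⟩
    a C suc m + (a C m + rest a)                  ≡⟨ sym (+-assoc (a C suc m) (a C m) _) ⟩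
    (a C suc m + a C m) + rest a                  ≡⟨ cong (_+ rest a) (trans (+-comm (a C suc m) (a C m)) (pascal a m)) ⟩
    suc a C suc m + rest a
      ≡⟨ cong (suc a C suc m +_) (sumBelow-cong T (λ i _ → cong (_C m) (+-suc a i))) ⟩
    suc a C suc m + sumBelow T (λ i → (suc a + i) C m)  ≡⟨ hockeyStick (suc a) m T ⟩
    (suc a + T) C suc m                           ≡⟨ cong (_C suc m) (sym (+-suc a T)) ⟩
    (a + suc T) C suc m                           ∎
    where
    open ≡-Reasoning
    rest : ℕ → ℕ
    rest a = sumBelow T (λ i → (a + suc i) C m)

  binomial-factorials : ∀ N M → M ≤ N → (N C M) * (M ! * (N ∸ M) !) ≡ N !
  binomial-factorials N M M≤N =
    trans (cong (_* (M ! * (N ∸ M) !)) (nCk≡n!/k![n-k]! M≤N))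
          (m/n*n≡m {{M !* (N ∸ M) !≢0}} (k![n∸k]!∣n! M≤N))

module TreeCounts (j : ℕ) where
  open import Data.Nat
  open import Data.Nat.Properties
  open import Data.Nat.Combinatorics using (_C_; nC1≡n)
  open import Data.Nat.DivMod using (m*n/n≡m)
  open import Data.Nat.Tactic.RingSolver using (solve-∀)
  open import Function using (_∘_)
  open import Relation.Binary.PropositionalEquality
  open FiniteSums
  open GeneratingTrees using (treeCount)
  open Binomials

  k : ℕ
  k = suc j

  pyramidArity : ℕ → ℕ
  pyramidArity u = u + (k + j)

  pyramidChildLabel : ℕ → ℕ → ℕ
  pyramidChildLabel u i = i ∸ j

  halfArity : ℕ → ℕ
  halfArity q = q + k

  halfChildLabel : ℕ → ℕ → ℕ
  halfChildLabel q i = i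

  pyramidTreeCount : ℕ → ℕ → ℕ
  pyramidTreeCount = treeCount pyramidArity pyramidChildLabel

  halfTreeCount : ℕ → ℕ → ℕ
  halfTreeCount = treeCount halfArity halfChildLabel

  binomial-shift : ∀ m → (k * m + j) C suc m ≡ j * ((k * m + j) C m)
  binomial-shift m = +-cancelˡ-≡ (N C m) _ _ (*-cancelˡ-≡ _ _ (suc m) scaled)
    where
    N = k * m + j
    expand : ∀ j m x → suc (suc j * m + j) * x ≡ suc m * (x + j * x)
    expand = solve-∀
    scaled : suc m * (N C m + N C suc m) ≡ suc m * (N C m + j * (N C m))
    scaled = trans (cong (suc m *_) (pascal N m)) (trans (absorption N m) (expand j m (N C m)))

  binomial-absorb : ∀ m → (k * m + k) C suc m ≡ k * ((k * m + j) C m)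
  binomial-absorb m = *-cancelˡ-≡ _ _ (suc m)
    (trans (cong (λ x → suc m * (x C suc m)) (sym (top j m)))
      (trans (absorption (k * m + j) m) (expand j m ((k * m + j) C m))))
    where
    top : ∀ j m → suc (suc j * m + j) ≡ suc j * m + suc j
    top = solve-∀
    expand : ∀ j m x → suc (suc j * m + j) * x ≡ suc m * (suc j * x)
    expand = solve-∀

  -- The j children with label 0 contribute j·C(km+j, m) = C(km+j, m+1),
  -- and the remaining u + k children sum up by the hockey-stick identity.
  pyramidTreeCount-closed : ∀ m u → pyramidTreeCount m u ≡ (k * m + u + j) C m
  pyramidTreeCount-closed zero    u = refl
  pyramidTreeCount-closed (suc m) u = begin
    sumBelow (u + (k + j)) (pyramidTreeCount m ∘ (_∸ j))
      ≡⟨ sumBelow-cong (u + (k + j)) (λ i _ → pyramidTreeCount-closed m (i ∸ j)) ⟩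
    sumBelow (u + (k + j)) f
      ≡⟨ cong (λ n → sumBelow n f) (reorder₁ u j) ⟩
    sumBelow (j + (u + k)) f
      ≡⟨ sumBelow-split j (u + k) f ⟩
    sumBelow j f + sumBelow (u + k) (λ i → f (j + i))
      ≡⟨ cong₂ _+_ (sumBelow-cong j (λ i i<j → cong (λ x → (k * m + x + j) C m) (m≤n⇒m∸n≡0 (<⇒≤ i<j))))
                   (sumBelow-cong (u + k) (λ i _ → cong (_C m) (trans (cong (λ x → k * m + x + j) (m+n∸m≡n j i))
                                                                     (reorder₂ (k * m) i j)))) ⟩
    sumBelow j (λ _ → (k * m + 0 + j) C m) + sumBelow (u + k) (λ i → (N + i) C m)
      ≡⟨ cong (_+ sumBelow (u + k) (λ i → (N + i) C m))
              (trans (sumBelow-const j _) (trans (cong (λ x → j * ((x + j) C m)) (+-identityʳ (k * m)))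
                                                 (sym (binomial-shift m)))) ⟩
    N C suc m + sumBelow (u + k) (λ i → (N + i) C m)
      ≡⟨ hockeyStick N m (u + k) ⟩
    (N + (u + k)) C suc m
      ≡⟨ cong (_C suc m) (reorder₃ j m u) ⟩
    (k * suc m + u + j) C suc m
      ∎
    where
    open ≡-Reasoning
    N = k * m + j
    f : ℕ → ℕ
    f i = (k * m + (i ∸ j) + j) C m
    reorder₁ : ∀ u j → u + (suc j + j) ≡ j + (u + suc j)
    reorder₁ = solve-∀
    reorder₂ : ∀ a i j → a + i + j ≡ a + j + i
    reorder₂ = solve-∀
    reorder₃ : ∀ j m u → suc j * m + j + (u + suc j) ≡ suc j * suc m + u + j
    reorder₃ = solve-∀

  -- Recurrence for the half-pyramid tree, in subtraction-free form:
  --   H(m + 1, q) + k · C(k(m+1) + q + j, m) = C(k(m+1) + q + k, m + 1).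
  halfTreeCount-binomial : ∀ m q → halfTreeCount (suc m) q + k * ((k * suc m + q + j) C m)
                                   ≡ (k * suc m + q + k) C suc m
  halfTreeCount-binomial zero q rewrite sumBelow-const (q + k) 1 | nC1≡n (k * 1 + q + k) = arith j q
    where
    arith : ∀ j q → (q + suc j) * 1 + suc j * 1 ≡ suc j * 1 + q + suc j
    arith = solve-∀
  halfTreeCount-binomial (suc m) q = begin
    S + k * ((k * suc m′ + q + j) C m′)  ≡⟨ cong (λ x → S + k * (x C m′)) (reorder₁ j m′ q) ⟩
    S + k * ((a₁ + T) C m′)              ≡⟨ cong (λ x → S + k * x) (sym (hockeyStick a₁ m T)) ⟩
    S + k * (a₁ C m′ + S₁)               ≡⟨ regroup S k (a₁ C m′) S₁ ⟩
    (S + k * S₁) + k * (a₁ C m′)         ≡⟨ cong₂ _+_ termwise (sym (binomial-absorb m′)) ⟩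
    S₂ + a₂ C suc m′                     ≡⟨ trans (+-comm S₂ _) (hockeyStick a₂ m′ T) ⟩
    (a₂ + T) C suc m′                    ≡⟨ cong (_C suc m′) (reorder₂ j m′ q) ⟩
    (k * suc m′ + q + k) C suc m′        ∎
    where
    open ≡-Reasoning
    m′ = suc m
    T = q + k
    a₁ = k * m′ + j
    a₂ = k * m′ + k
    S = sumBelow T (halfTreeCount m′)
    S₁ = sumBelow T (λ i → (a₁ + i) C m)
    S₂ = sumBelow T (λ i → (a₂ + i) C m′)
    reorder₁ : ∀ j m′ q → suc j * suc m′ + q + j ≡ suc j * m′ + j + (q + suc j)
    reorder₁ = solve-∀
    reorder₂ : ∀ j m′ q → suc j * m′ + suc j + (q + suc j) ≡ suc j * suc m′ + q + suc j
    reorder₂ = solve-∀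
    regroup : ∀ s k x s₁ → s + k * (x + s₁) ≡ (s + k * s₁) + k * x
    regroup = solve-∀
    swap : ∀ a i j → a + i + j ≡ a + j + i
    swap = solve-∀
    termwise : S + k * S₁ ≡ S₂
    termwise = begin
      S + k * S₁
        ≡⟨ cong (S +_) (sym (sumBelow-* T k (λ i → (a₁ + i) C m))) ⟩
      S + sumBelow T (λ i → k * ((a₁ + i) C m))
        ≡⟨ sym (sumBelow-+ T (halfTreeCount m′) (λ i → k * ((a₁ + i) C m))) ⟩
      sumBelow T (λ i → halfTreeCount m′ i + k * ((a₁ + i) C m))
        ≡⟨ sumBelow-cong T (λ i _ → trans (cong (λ x → halfTreeCount m′ i + k * (x C m)) (swap (k * m′) j i))
                                          (trans (halfTreeCount-binomial m i) (cong (_C m′) (swap (k * m′) i k)))) ⟩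
      S₂
        ∎

  -- (m + 1) · H(m, 0) = C(k(m + 1), m): multiply the recurrence at q = 0 by
  -- m + 1 and cancel the binomial term with absorption.
  halfTreeCount-root : ∀ m → suc m * halfTreeCount m 0 ≡ (k * suc m) C m
  halfTreeCount-root zero    = refl
  halfTreeCount-root (suc m) =
    +-cancelʳ-≡ (M * Y) (n * A) Y
      (trans (cong (n * A +_) absorbed) (trans (factor n A k X) (cong (n *_) recurrence)))
    where
    M = suc m
    n = suc M
    A = halfTreeCount M 0
    X = (k * M + 0 + j) C m
    Y = (k * n) C M
    top : ∀ j M → suc (suc j * M + 0 + j) ≡ suc j * suc M
    top = solve-∀
    recurrence : A + k * X ≡ Y
    recurrence = trans (halfTreeCount-binomial m 0) (cong (_C M) (length-eq j M))
      where
      length-eq : ∀ j M → suc j * M + 0 + suc j ≡ suc j * suc M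
      length-eq = solve-∀
    absorbed : M * Y ≡ (k * n) * X
    absorbed = trans (cong (λ x → M * (x C M)) (sym (top j M)))
                     (trans (absorption (k * M + 0 + j) m) (cong (_* X) (top j M)))
    factor : ∀ n a k x → n * a + (k * n) * x ≡ n * (a + k * x)
    factor = solve-∀

  divide-exact : ∀ x y .{{_ : NonZero y}} a → x ≡ a * y → x / y ≡ a
  divide-exact x y a refl = m*n/n≡m a y

  halfTree-total : ∀ m → halfTreeCount m 0 ≡ halfPyramidCount k (suc m)
  halfTree-total m =
    sym (divide-exact _ _ {{suc m !* (N ∸ suc m + 1) !≢0}} A factorials)
    where
    n = suc m
    N = k * n
    A = halfTreeCount m 0
    n≤N : n ≤ N
    n≤N = m≤n*m n k
    N∸m : N ∸ m ≡ N ∸ n + 1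
    N∸m = trans (cong (_∸ m) (sym (m+[n∸m]≡n n≤N))) (shift m (N ∸ n))
      where
      shift : ∀ m d → (suc m + d) ∸ m ≡ d + 1
      shift zero    d = +-comm 1 d
      shift (suc m) d = shift m d
    factorials : N ! ≡ A * (n ! * (N ∸ n + 1) !)
    factorials = begin
      N !                                 ≡⟨ sym (binomial-factorials N m (≤-trans (n≤1+n m) n≤N)) ⟩
      (N C m) * (m ! * (N ∸ m) !)         ≡⟨ cong₂ (λ a b → a * (m ! * b !)) (sym (halfTreeCount-root m)) N∸m ⟩
      (n * A) * (m ! * (N ∸ n + 1) !)     ≡⟨ regroup n A (m !) ((N ∸ n + 1) !) ⟩
      A * (n ! * (N ∸ n + 1) !)           ∎
      where
      open ≡-Reasoning
      regroup : ∀ n a x y → (n * a) * (x * y) ≡ a * ((n * x) * y)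
      regroup = solve-∀

  pyramidTree-total : ∀ m → pyramidTreeCount m 0 ≡ pyramidCount k (suc m)
  pyramidTree-total m = sym (divide-exact _ k (pyramidTreeCount m 0) (trans scaled (*-comm k _)))
    where
    N = k * m + 0 + j
    top : ∀ j m → suc (suc j * m + 0 + j) ≡ suc j * suc m
    top = solve-∀
    expand : ∀ j m x → suc (suc j * m + 0 + j) * x ≡ suc m * (suc j * x)
    expand = solve-∀
    scaled : (k * suc m) C suc m ≡ k * pyramidTreeCount m 0
    scaled = *-cancelˡ-≡ _ _ (suc m)
      (trans (cong (λ x → suc m * (x C suc m)) (sym (top j m)))
        (trans (absorption N m)
          (trans (expand j m (N C m)) (cong (λ x → suc m * (k * x)) (sym (pyramidTreeCount-closed m 0))))))

-- Imports for the geometric part.  They follow the arithmetic modules above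
-- because the integer operators share their names with those on ℕ.
open import Data.Nat as ℕ using (ℕ; zero; suc; _∸_)
open import Data.Nat.Properties as ℕP using ()
open import Data.Integer as ℤ using (ℤ; +_; _+_; _-_; _<_; _≤_; -_; _<?_; _≤?_; ∣_∣; _⊓_; _⊖_)
open import Data.Integer.Properties
open import Data.Integer.Tactic.RingSolver using (solve-∀)
open import Data.Bool using (Bool; true; false; T; if_then_else_)
open import Data.Unit using (⊤; tt)
open import Data.Empty using (⊥; ⊥-elim)
open import Data.Product using (Σ; _×_; _,_; proj₁; proj₂)
open import Data.Sum using (_⊎_; inj₁; inj₂; [_,_]′)
open import Data.Maybe using (Maybe; just; nothing)
open import Data.List using (List; []; _∷_; length)
open import Data.Bool.ListAction using (all; any)
open import Data.List.Relation.Unary.Any using (Any; here; there)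
open import Data.List.Relation.Unary.All using (All; []; _∷_)
open import Data.List.Membership.Propositional using (_∈_)
open import Data.Fin using (Fin)
open import Function.Bundles using (_↔_)
open import Relation.Nullary using (¬_; yes; no)
open import Relation.Nullary.Decidable using (⌊_⌋; toWitness; fromWitness)
open import Relation.Binary.PropositionalEquality
open BooleanReflection

module Floors (j : ℕ) where

  k : ℕ
  k = suc j

  K : ℤ
  K = + k

  plus-minus : ∀ a c → (a + c) - c ≡ a
  plus-minus = solve-∀

  minus-plus : ∀ a c → (a - c) + c ≡ a
  minus-plus = solve-∀

  +-cancelʳ-< : ∀ {a b} c → a + c < b + c → a < b
  +-cancelʳ-< {a} {b} c h = subst₂ _<_ (plus-minus a c) (plus-minus b c) (+-monoˡ-< (- c) h)

  +-cancelʳ-≤ : ∀ {a b} c → a + c ≤ b + c → a ≤ b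
  +-cancelʳ-≤ {a} {b} c h = subst₂ _≤_ (plus-minus a c) (plus-minus b c) (+-monoˡ-≤ (- c) h)

  a<a+K : ∀ a → a < a + K
  a<a+K a = subst (_< a + K) (+-identityʳ a) (+-monoʳ-< a (ℤ.+<+ (ℕ.s≤s ℕ.z≤n)))

  a≤a+K : ∀ a → a ≤ a + K
  a≤a+K a = <⇒≤ (a<a+K a)

  apart⇒< : ∀ {a b} → a + K ≤ b → a < b
  apart⇒< {a} h = <-≤-trans (a<a+K a) h

  apart-trans : ∀ {a b c} → a + K ≤ b → b + K ≤ c → a + K ≤ c
  apart-trans h₁ h₂ = ≤-trans h₁ (≤-trans (a≤a+K _) h₂)

  -K<⇒<+K : ∀ {a b} → a - K < b → a < b + K
  -K<⇒<+K {a} {b} h = subst (_< b + K) (minus-plus a K) (+-monoˡ-< K h)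

  <+K⇒-K< : ∀ {a b} → a < b + K → a - K < b
  <+K⇒-K< {a} {b} h = subst (a - K <_) (plus-minus b K) (+-monoˡ-< (- K) h)

  Overlap : ℤ → ℤ → Set
  Overlap c x = (x < c + K) × (c < x + K)

  overlap-sym : ∀ {c x} → Overlap c x → Overlap x c
  overlap-sym (a , b) = b , a

  overlap-refl : ∀ c → Overlap c c
  overlap-refl c = a<a+K c , a<a+K c

  ¬overlap⇒apart : ∀ {p x} → ¬ Overlap p x → (p + K ≤ x) ⊎ (x + K ≤ p)
  ¬overlap⇒apart {p} {x} h with x <? p + K | p <? x + K
  ... | yes a | yes b = ⊥-elim (h (a , b))
  ... | no a  | _     = inj₁ (≮⇒≥ a)
  ... | yes _ | no b  = inj₂ (≮⇒≥ b)

  apart⇒¬overlap : ∀ {a b} → a + K ≤ b → ¬ Overlap a b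
  apart⇒¬overlap h (x , y) = <-irrefl refl (<-≤-trans x h)

  apart⇒¬overlap′ : ∀ {a b} → a + K ≤ b → ¬ Overlap b a
  apart⇒¬overlap′ h o = apart⇒¬overlap h (overlap-sym o)

  overlaps-sound : ∀ {c x} → T (overlaps k c x) → Overlap c x
  overlaps-sound {c} {x} h with x - K <? c | c <? x + K
  ... | yes a | yes b = -K<⇒<+K a , b
  ... | no _  | _     = ⊥-elim h
  ... | yes _ | no _  = ⊥-elim h

  overlaps-complete : ∀ {c x} → Overlap c x → T (overlaps k c x)
  overlaps-complete {c} {x} (a , b) with x - K <? c | c <? x + K
  ... | yes _ | yes _ = tt
  ... | no n  | _     = n (<+K⇒-K< a)
  ... | yes _ | no n  = n b

  hitsFloor : ℤ → Floor → Bool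
  hitsFloor p G = any (overlaps k p) G

  hits : ℤ → List Floor → Bool
  hits p R = any (hitsFloor p) R

  infix 4 _∈∈_
  _∈∈_ : ℤ → List Floor → Set
  x ∈∈ R = Any (x ∈_) R

  hitsFloor-sound : ∀ {p} G → T (hitsFloor p G) → Σ ℤ λ x → x ∈ G × Overlap p x
  hitsFloor-sound {p} (x ∷ G) h with ∨-elim {overlaps k p x} h
  ... | inj₁ o = x , here refl , overlaps-sound o
  ... | inj₂ r with hitsFloor-sound G r
  ... | y , m , o = y , there m , o

  hitsFloor-complete : ∀ {p x} G → x ∈ G → Overlap p x → T (hitsFloor p G)
  hitsFloor-complete {p} (y ∷ G) (here refl) o = ∨-inl {overlaps k p y} (overlaps-complete o)
  hitsFloor-complete {p} (y ∷ G) (there m)   o = ∨-inr {overlaps k p y} (hitsFloor-complete G m o)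

  hits-sound : ∀ {p} R → T (hits p R) → Σ ℤ λ x → x ∈∈ R × Overlap p x
  hits-sound {p} (G ∷ R) h with ∨-elim {hitsFloor p G} h
  ... | inj₁ o with hitsFloor-sound G o
  ... | x , m , ov = x , here m , ov
  hits-sound {p} (G ∷ R) h | inj₂ r with hits-sound R r
  ... | y , m , o = y , there m , o

  hits-complete : ∀ {p x} R → x ∈∈ R → Overlap p x → T (hits p R)
  hits-complete {p} (G ∷ R) (here m)  o = ∨-inl {hitsFloor p G} (hitsFloor-complete G m o)
  hits-complete {p} (G ∷ R) (there m) o = ∨-inr {hitsFloor p G} (hits-complete R m o)

  ¬hits-tail : ∀ {p} G R → ¬ T (hits p (G ∷ R)) → ¬ T (hits p R)
  ¬hits-tail {p} G R c x = c (∨-inr {hitsFloor p G} x)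

  ¬hits-head : ∀ {p} G R → ¬ T (hits p (G ∷ R)) → ¬ T (hitsFloor p G)
  ¬hits-head {p} G R c x = c (∨-inl {hitsFloor p G} x)

  record Sorted (G : Floor) : Set where
    constructor sorted
    field unsorted : T (disjointFloor k G)
  open Sorted public

  sorted-tail : ∀ {x xs} → Sorted (x ∷ xs) → Sorted xs
  sorted-tail {x} {[]}     _          = sorted tt
  sorted-tail {x} {y ∷ ys} (sorted h) = sorted (∧-snd {⌊ x + + k ≤? y ⌋} h)

  sorted-head : ∀ {x y ys} → Sorted (x ∷ y ∷ ys) → x + K ≤ y
  sorted-head {x} {y} (sorted h) = toWitness (∧-fst {⌊ x + + k ≤? y ⌋} h)

  sorted-all : ∀ {x xs} → Sorted (x ∷ xs) → ∀ {y} → y ∈ xs → x + K ≤ y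
  sorted-all {x} {y ∷ ys} h (here refl) = sorted-head h
  sorted-all {x} {y ∷ ys} h (there m)   = apart-trans {x} (sorted-head h) (sorted-all (sorted-tail h) m)

  sorted-cons : ∀ {x xs} → Sorted xs → (∀ {y} → y ∈ xs → x + K ≤ y) → Sorted (x ∷ xs)
  sorted-cons {x} {[]}     s          f = sorted tt
  sorted-cons {x} {y ∷ ys} (sorted s) f = sorted (∧-intro (fromWitness (f (here refl))) s)

  sorted-overlap⇒≡ : ∀ {G x y} → Sorted G → x ∈ G → y ∈ G → Overlap x y → x ≡ y
  sorted-overlap⇒≡ {x ∷ G} s (here refl) (here refl) o = refl
  sorted-overlap⇒≡ {x ∷ G} s (here refl) (there m)   o = ⊥-elim (apart⇒¬overlap (sorted-all s m) o)
  sorted-overlap⇒≡ {x ∷ G} s (there m)   (here refl) o = ⊥-elim (apart⇒¬overlap′ (sorted-all s m) o)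
  sorted-overlap⇒≡ {x ∷ G} s (there m)   (there m′)  o = sorted-overlap⇒≡ (sorted-tail s) m m′ o

  insert : ℤ → Floor → Floor
  insert p [] = p ∷ []
  insert p (x ∷ xs) with p <? x
  ... | yes _ = p ∷ x ∷ xs
  ... | no _  = x ∷ insert p xs

  remove : ℤ → Floor → Floor
  remove p [] = []
  remove p (x ∷ xs) with p ℤ.≟ x
  ... | yes _ = xs
  ... | no _  = x ∷ remove p xs

  ∈-insert⁻ : ∀ {p y} G → y ∈ insert p G → y ≡ p ⊎ y ∈ G
  ∈-insert⁻ [] (here refl) = inj₁ refl
  ∈-insert⁻ {p} (x ∷ xs) m with p <? x
  ∈-insert⁻ {p} (x ∷ xs) (here refl) | yes _ = inj₁ refl
  ∈-insert⁻ {p} (x ∷ xs) (there m) | yes _ = inj₂ m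
  ∈-insert⁻ {p} (x ∷ xs) (here refl) | no _ = inj₂ (here refl)
  ∈-insert⁻ {p} (x ∷ xs) (there m) | no _ with ∈-insert⁻ xs m
  ... | inj₁ e = inj₁ e
  ... | inj₂ m′ = inj₂ (there m′)

  ∈-insert-new : ∀ p G → p ∈ insert p G
  ∈-insert-new p [] = here refl
  ∈-insert-new p (x ∷ xs) with p <? x
  ... | yes _ = here refl
  ... | no _ = there (∈-insert-new p xs)

  ∈-insert-old : ∀ {y} p G → y ∈ G → y ∈ insert p G
  ∈-insert-old p (x ∷ xs) m with p <? x
  ... | yes _ = there m
  ∈-insert-old p (x ∷ xs) (here refl) | no _ = here refl
  ∈-insert-old p (x ∷ xs) (there m) | no _ = there (∈-insert-old p xs m)

  sorted-insert : ∀ {p} G → Sorted G → ¬ T (hitsFloor p G) → Sorted (insert p G)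
  sorted-insert [] s c = sorted tt
  sorted-insert {p} (x ∷ xs) s c with p <? x
  ... | yes p<x with ¬overlap⇒apart {p} {x} (λ o → c (hitsFloor-complete (x ∷ xs) (here refl) o))
  ... | inj₁ h = sorted (∧-intro (fromWitness h) (unsorted s))
  ... | inj₂ h = ⊥-elim (<-asym p<x (apart⇒< {x} h))
  sorted-insert {p} (x ∷ xs) s c | no p≮x =
    sorted-cons (sorted-insert xs (sorted-tail s) (λ o → c (∨-inr {overlaps k p x} o))) right-of-x
    where
    right-of-x : ∀ {y} → y ∈ insert p xs → x + K ≤ y
    right-of-x m with ∈-insert⁻ xs m
    ... | inj₂ m′ = sorted-all s m′
    ... | inj₁ refl with ¬overlap⇒apart {p} {x} (λ o → c (hitsFloor-complete (x ∷ xs) (here refl) o))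
    ... | inj₁ h = ⊥-elim (p≮x (apart⇒< {p} h))
    ... | inj₂ h = h

  ∈-remove⁻ : ∀ {p y} G → y ∈ remove p G → y ∈ G
  ∈-remove⁻ {p} (x ∷ xs) m with p ℤ.≟ x
  ... | yes _ = there m
  ∈-remove⁻ {p} (x ∷ xs) (here refl) | no _ = here refl
  ∈-remove⁻ {p} (x ∷ xs) (there m) | no _ = there (∈-remove⁻ xs m)

  ∈-remove⁺ : ∀ {p y} G → y ∈ G → y ≢ p → y ∈ remove p G
  ∈-remove⁺ {p} (x ∷ xs) m ne with p ℤ.≟ x
  ∈-remove⁺ {p} (x ∷ xs) (here refl) ne | yes refl = ⊥-elim (ne refl)
  ∈-remove⁺ {p} (x ∷ xs) (there m) ne | yes refl = m
  ∈-remove⁺ {p} (x ∷ xs) (here refl) ne | no _ = here refl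
  ∈-remove⁺ {p} (x ∷ xs) (there m) ne | no _ = there (∈-remove⁺ xs m ne)

  sorted-remove : ∀ {p} G → Sorted G → Sorted (remove p G)
  sorted-remove [] s = s
  sorted-remove {p} (x ∷ xs) s with p ℤ.≟ x
  ... | yes _ = sorted-tail s
  ... | no _ = sorted-cons (sorted-remove xs (sorted-tail s)) (λ m → sorted-all s (∈-remove⁻ xs m))

  remove-insert : ∀ {p} G → ¬ (p ∈ G) → remove p (insert p G) ≡ G
  remove-insert {p} [] n with p ℤ.≟ p
  ... | yes _ = refl
  ... | no ne = ⊥-elim (ne refl)
  remove-insert {p} (x ∷ xs) n with p <? x
  ... | yes _ with p ℤ.≟ p
  ... | yes _ = refl
  ... | no ne = ⊥-elim (ne refl)
  remove-insert {p} (x ∷ xs) n | no _ with p ℤ.≟ x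
  ... | yes refl = ⊥-elim (n (here refl))
  ... | no _ = cong (x ∷_) (remove-insert xs (λ m → n (there m)))

  insert-remove : ∀ {p} G → Sorted G → p ∈ G → insert p (remove p G) ≡ G
  insert-remove {p} (x ∷ xs) s m with p ℤ.≟ x
  insert-remove {p} (x ∷ []) s m | yes refl = refl
  insert-remove {p} (x ∷ y ∷ ys) s m | yes refl with p <? y
  ... | yes _ = refl
  ... | no n = ⊥-elim (n (apart⇒< {p} (sorted-head s)))
  insert-remove {p} (x ∷ xs) s (here refl) | no ne = ⊥-elim (ne refl)
  insert-remove {p} (x ∷ xs) s (there m) | no ne with p <? x
  ... | yes p<x = ⊥-elim (<-asym p<x (apart⇒< {x} (sorted-all s m)))
  ... | no _ = cong (x ∷_) (insert-remove xs (sorted-tail s) m)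

  remove≡[] : ∀ {p} G → p ∈ G → remove p G ≡ [] → G ≡ p ∷ []
  remove≡[] {p} (x ∷ xs) m e with p ℤ.≟ x
  remove≡[] {p} (x ∷ xs) m refl | yes refl = refl
  remove≡[] {p} (x ∷ xs) m () | no _

  length-insert : ∀ p G → length (insert p G) ≡ suc (length G)
  length-insert p [] = refl
  length-insert p (x ∷ xs) with p <? x
  ... | yes _ = refl
  ... | no _ = cong suc (length-insert p xs)

-- Dropping a piece at p
-- onto floors F ∷ R lets it fall until it rests on the highest floor
-- containing a piece it overlaps: it is inserted into the floor just above
-- that one (a new top floor if necessary).  A piece is maximal if no piece
-- of a higher floor overlaps it; removeLM removes the leftmost maximal piece.
-- The heart of the bijections is that these two moves are mutually inverse
-- (removeLM-dropPiece, dropPiece-removeLM).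
module TowerMoves (j : ℕ) where
  open Floors j

  placeOnTop : ℤ → List Floor → List Floor
  placeOnTop p []      = (p ∷ []) ∷ []
  placeOnTop p (G ∷ R) = insert p G ∷ R

  dropPiece : ℤ → List Floor → List Floor
  dropPiece p []      = (p ∷ []) ∷ []
  dropPiece p (F ∷ R) = if hits p R then F ∷ dropPiece p R else F ∷ placeOnTop p R

  firstFree : Floor → List Floor → Maybe ℤ
  firstFree []       R = nothing
  firstFree (x ∷ xs) R = if hits x R then firstFree xs R else just x

  -- whether a candidate from higher floors is strictly left of one below
  preferUpper : Maybe ℤ → Maybe ℤ → Bool
  preferUpper a        nothing  = false
  preferUpper nothing  (just b) = true
  preferUpper (just a) (just b) = ⌊ b <? a ⌋

  leftmostOf : Maybe ℤ → Maybe ℤ → Maybe ℤ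
  leftmostOf a b = if preferUpper a b then b else a

  leftmostMaximal : List Floor → Maybe ℤ
  leftmostMaximal []      = nothing
  leftmostMaximal (F ∷ R) = leftmostOf (firstFree F R) (leftmostMaximal R)

  consNonEmpty : Floor → List Floor → List Floor
  consNonEmpty []       R = R
  consNonEmpty (x ∷ xs) R = (x ∷ xs) ∷ R

  removeFromFloor : Maybe ℤ → Floor → List Floor → List Floor
  removeFromFloor nothing  F R = F ∷ R
  removeFromFloor (just a) F R = consNonEmpty (remove a F) R

  removeLM : List Floor → List Floor
  removeLM []      = []
  removeLM (F ∷ R) =
    if preferUpper (firstFree F R) (leftmostMaximal R)
    then F ∷ removeLM R
    else removeFromFloor (firstFree F R) F R

  Maximal : ℤ → List Floor → Set
  Maximal y []      = ⊥
  Maximal y (F ∷ R) = (y ∈ F × ¬ T (hits y R)) ⊎ Maximal y R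

  AllSorted : List Floor → Set
  AllSorted R = All Sorted R

  maximal⇒∈∈ : ∀ {y} R → Maximal y R → y ∈∈ R
  maximal⇒∈∈ (F ∷ R) (inj₁ (m , _)) = here m
  maximal⇒∈∈ (F ∷ R) (inj₂ x)       = there (maximal⇒∈∈ R x)

  firstFree-sound : ∀ {a} F R → firstFree F R ≡ just a → a ∈ F × ¬ T (hits a R)
  firstFree-sound (x ∷ xs) R e with hits x R in eq
  firstFree-sound (x ∷ xs) R e | true with firstFree-sound xs R e
  ... | m , u = there m , u
  firstFree-sound (x ∷ xs) R refl | false = here refl , false⇒¬T eq

  firstFree-least : ∀ {y} F R → Sorted F → y ∈ F → ¬ T (hits y R) → Σ ℤ λ a → firstFree F R ≡ just a × a ≤ y
  firstFree-least (x ∷ xs) R s m u with hits x R in eq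
  firstFree-least (x ∷ xs) R s (here refl) u | true = ⊥-elim (u (true⇒T eq))
  firstFree-least (x ∷ xs) R s (there m) u | true = firstFree-least xs R (sorted-tail s) m u
  firstFree-least (x ∷ xs) R s (here refl) u | false = x , refl , ≤-refl
  firstFree-least (x ∷ xs) R s (there m) u | false = x , refl , <⇒≤ (apart⇒< {x} (sorted-all s m))

  leftmostOf-≤ˡ : ∀ a′ b → Σ ℤ λ p → leftmostOf (just a′) b ≡ just p × p ≤ a′
  leftmostOf-≤ˡ a′ nothing = a′ , refl , ≤-refl
  leftmostOf-≤ˡ a′ (just b) with b <? a′
  ... | yes lt = b , refl , <⇒≤ lt
  ... | no _ = a′ , refl , ≤-refl

  leftmostOf-≤ʳ : ∀ a b′ → Σ ℤ λ p → leftmostOf a (just b′) ≡ just p × p ≤ b′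
  leftmostOf-≤ʳ nothing b′ = b′ , refl , ≤-refl
  leftmostOf-≤ʳ (just a) b′ with b′ <? a
  ... | yes _ = b′ , refl , ≤-refl
  ... | no n = a , refl , ≮⇒≥ n

  leftmostMaximal-sound : ∀ {p} R → leftmostMaximal R ≡ just p → Maximal p R
  leftmostMaximal-sound (F ∷ R) e with preferUpper (firstFree F R) (leftmostMaximal R)
  ... | true = inj₂ (leftmostMaximal-sound R e)
  ... | false = inj₁ (firstFree-sound F R e)

  leftmostMaximal-least : ∀ {y} R → AllSorted R → Maximal y R → Σ ℤ λ p → leftmostMaximal R ≡ just p × p ≤ y
  leftmostMaximal-least (F ∷ R) (s ∷ ss) (inj₁ (m , u)) with firstFree-least F R s m u
  ... | a , e , le rewrite e with leftmostOf-≤ˡ a (leftmostMaximal R)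
  ... | p , e′ , le′ = p , e′ , ≤-trans le′ le
  leftmostMaximal-least (F ∷ R) (s ∷ ss) (inj₂ x) with leftmostMaximal-least R ss x
  ... | b , e , le rewrite e with leftmostOf-≤ʳ (firstFree F R) b
  ... | p , e′ , le′ = p , e′ , ≤-trans le′ le

  leftmostMaximal-unique : ∀ {p} R → AllSorted R → Maximal p R → (∀ y → Maximal y R → p ≤ y) →
                           leftmostMaximal R ≡ just p
  leftmostMaximal-unique R ss mx f with leftmostMaximal-least R ss mx
  ... | q , e , le = trans e (cong just (≤-antisym le (f q (leftmostMaximal-sound R e))))

  leftmostMaximal-≤ : ∀ {p y} R → AllSorted R → leftmostMaximal R ≡ just p → Maximal y R → p ≤ y
  leftmostMaximal-≤ R ss e mx with leftmostMaximal-least R ss mx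
  ... | q , e′ , le with trans (sym e) e′
  ... | refl = le

  ∈∈-placeOnTop⁻ : ∀ {p y} R → y ∈∈ placeOnTop p R → y ≡ p ⊎ y ∈∈ R
  ∈∈-placeOnTop⁻ [] (here (here refl)) = inj₁ refl
  ∈∈-placeOnTop⁻ (G ∷ R) (here m) with ∈-insert⁻ G m
  ... | inj₁ e = inj₁ e
  ... | inj₂ m′ = inj₂ (here m′)
  ∈∈-placeOnTop⁻ (G ∷ R) (there m) = inj₂ (there m)

  ∈∈-placeOnTop-new : ∀ p R → p ∈∈ placeOnTop p R
  ∈∈-placeOnTop-new p [] = here (here refl)
  ∈∈-placeOnTop-new p (G ∷ R) = here (∈-insert-new p G)

  ∈∈-placeOnTop-old : ∀ {y} p R → y ∈∈ R → y ∈∈ placeOnTop p R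
  ∈∈-placeOnTop-old p (G ∷ R) (here m) = here (∈-insert-old p G m)
  ∈∈-placeOnTop-old p (G ∷ R) (there m) = there m

  ∈∈-dropPiece⁻ : ∀ {p y} R → y ∈∈ dropPiece p R → y ≡ p ⊎ y ∈∈ R
  ∈∈-dropPiece⁻ [] (here (here refl)) = inj₁ refl
  ∈∈-dropPiece⁻ {p} (F ∷ R) m with hits p R
  ∈∈-dropPiece⁻ {p} (F ∷ R) (here m) | true = inj₂ (here m)
  ∈∈-dropPiece⁻ {p} (F ∷ R) (there m) | true with ∈∈-dropPiece⁻ R m
  ... | inj₁ e = inj₁ e
  ... | inj₂ m′ = inj₂ (there m′)
  ∈∈-dropPiece⁻ {p} (F ∷ R) (here m) | false = inj₂ (here m)
  ∈∈-dropPiece⁻ {p} (F ∷ R) (there m) | false with ∈∈-placeOnTop⁻ R m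
  ... | inj₁ e = inj₁ e
  ... | inj₂ m′ = inj₂ (there m′)

  ∈∈-dropPiece-new : ∀ p R → p ∈∈ dropPiece p R
  ∈∈-dropPiece-new p [] = here (here refl)
  ∈∈-dropPiece-new p (F ∷ R) with hits p R
  ... | true = there (∈∈-dropPiece-new p R)
  ... | false = there (∈∈-placeOnTop-new p R)

  ∈∈-dropPiece-old : ∀ {y} p R → y ∈∈ R → y ∈∈ dropPiece p R
  ∈∈-dropPiece-old p (F ∷ R) m with hits p R
  ∈∈-dropPiece-old p (F ∷ R) (here m) | true = here m
  ∈∈-dropPiece-old p (F ∷ R) (there m) | true = there (∈∈-dropPiece-old p R m)
  ∈∈-dropPiece-old p (F ∷ R) (here m) | false = here m
  ∈∈-dropPiece-old p (F ∷ R) (there m) | false = there (∈∈-placeOnTop-old p R m)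

  free-in-sub : ∀ {a p} R D → (∀ {y} → y ∈∈ R → y ∈∈ D) → p ∈∈ D →
            ¬ T (hits a D) → ¬ T (hits a R) × ¬ Overlap a p
  free-in-sub R D sub pm u = (λ c → let (x , m , o) = hits-sound R c in u (hits-complete D (sub m) o))
                       , (λ o → u (hits-complete D pm o))

  maximal-placeOnTop : ∀ {p y} R → ¬ T (hits p R) → Maximal y (placeOnTop p R) →
                       y ≡ p ⊎ (Maximal y R × ¬ Overlap y p)
  maximal-placeOnTop [] c (inj₁ (here refl , _)) = inj₁ refl
  maximal-placeOnTop {p} {y} (G ∷ R) c (inj₁ (m , u)) with ∈-insert⁻ G m
  ... | inj₁ e = inj₁ e
  ... | inj₂ m′ = inj₂ (inj₁ (m′ , u) , λ o → c (hits-complete (G ∷ R) (here m′) (overlap-sym o)))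
  maximal-placeOnTop {p} {y} (G ∷ R) c (inj₂ mx) =
    inj₂ (inj₂ mx , λ o → c (hits-complete (G ∷ R) (there (maximal⇒∈∈ R mx)) (overlap-sym o)))

  maximal-dropPiece : ∀ {p y} R → Maximal y (dropPiece p R) → y ≡ p ⊎ (Maximal y R × ¬ Overlap y p)
  maximal-dropPiece [] (inj₁ (here refl , _)) = inj₁ refl
  maximal-dropPiece {p} (F ∷ R) mx with hits p R in eq
  maximal-dropPiece {p} (F ∷ R) (inj₁ (m , u)) | true =
    let (a , b) = free-in-sub R (dropPiece p R) (∈∈-dropPiece-old p R) (∈∈-dropPiece-new p R) u
    in inj₂ (inj₁ (m , a) , b)
  maximal-dropPiece {p} (F ∷ R) (inj₂ mx) | true with maximal-dropPiece R mx
  ... | inj₁ e = inj₁ e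
  ... | inj₂ (a , b) = inj₂ (inj₂ a , b)
  maximal-dropPiece {p} (F ∷ R) (inj₁ (m , u)) | false =
    let (a , b) = free-in-sub R (placeOnTop p R) (∈∈-placeOnTop-old p R) (∈∈-placeOnTop-new p R) u
    in inj₂ (inj₁ (m , a) , b)
  maximal-dropPiece {p} (F ∷ R) (inj₂ mx) | false with maximal-placeOnTop R (false⇒¬T eq) mx
  ... | inj₁ e = inj₁ e
  ... | inj₂ (a , b) = inj₂ (inj₂ a , b)

  maximal-placeOnTop-new : ∀ p R → ¬ T (hits p R) → Maximal p (placeOnTop p R)
  maximal-placeOnTop-new p [] c = inj₁ (here refl , λ ())
  maximal-placeOnTop-new p (G ∷ R) c = inj₁ (∈-insert-new p G , ¬hits-tail G R c)

  maximal-dropPiece-new : ∀ p R → Maximal p (dropPiece p R)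
  maximal-dropPiece-new p [] = inj₁ (here refl , λ ())
  maximal-dropPiece-new p (F ∷ R) with hits p R in eq
  ... | true = inj₂ (maximal-dropPiece-new p R)
  ... | false = inj₂ (maximal-placeOnTop-new p R (false⇒¬T eq))

  sorted-placeOnTop : ∀ p R → AllSorted R → ¬ T (hits p R) → AllSorted (placeOnTop p R)
  sorted-placeOnTop p [] _ _ = sorted tt ∷ []
  sorted-placeOnTop p (G ∷ R) (s ∷ ss) c = sorted-insert G s (¬hits-head G R c) ∷ ss

  sorted-dropPiece : ∀ p R → AllSorted R → AllSorted (dropPiece p R)
  sorted-dropPiece p [] _ = sorted tt ∷ []
  sorted-dropPiece p (F ∷ R) (s ∷ ss) with hits p R in eq
  ... | true = s ∷ sorted-dropPiece p R ss
  ... | false = s ∷ sorted-placeOnTop p R ss (false⇒¬T eq)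

  pieces-placeOnTop : ∀ p R → pieces (placeOnTop p R) ≡ suc (pieces R)
  pieces-placeOnTop p [] = refl
  pieces-placeOnTop p (G ∷ R) = cong (ℕ._+ pieces R) (length-insert p G)

  pieces-dropPiece : ∀ p R → pieces (dropPiece p R) ≡ suc (pieces R)
  pieces-dropPiece p [] = refl
  pieces-dropPiece p (F ∷ R) with hits p R
  ... | true = trans (cong (length F ℕ.+_) (pieces-dropPiece p R)) (ℕP.+-suc (length F) (pieces R))
  ... | false = trans (cong (length F ℕ.+_) (pieces-placeOnTop p R)) (ℕP.+-suc (length F) (pieces R))

  record Stack (F : Floor) (R : List Floor) : Set where
    constructor stack
    field unstack : T (upperFloorsOK k F R)
  open Stack public

  stack-nonempty : ∀ {F G R} → Stack F (G ∷ R) → T (nonempty G)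
  stack-nonempty {F} {G} (stack h) = ∧-fst {nonempty G} h

  stack-sorted : ∀ {F G R} → Stack F (G ∷ R) → Sorted G
  stack-sorted {F} {G} (stack h) = sorted (∧-fst {disjointFloor k G} (∧-snd {nonempty G} h))

  stack-supported : ∀ {F G R} → Stack F (G ∷ R) → T (supported k G F)
  stack-supported {F} {G} (stack h) = ∧-fst {supported k G F} (∧-snd {disjointFloor k G} (∧-snd {nonempty G} h))

  stack-tail : ∀ {F G R} → Stack F (G ∷ R) → Stack G R
  stack-tail {F} {G} (stack h) = stack (∧-snd {supported k G F} (∧-snd {disjointFloor k G} (∧-snd {nonempty G} h)))

  stack-cons : ∀ {F G R} → T (nonempty G) → Sorted G → T (supported k G F) → Stack G R → Stack F (G ∷ R)
  stack-cons a (sorted b) c (stack d) = stack (∧-intro a (∧-intro b (∧-intro c d)))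

  stack-sorted-all : ∀ {F} R → Stack F R → AllSorted R
  stack-sorted-all [] _ = []
  stack-sorted-all (G ∷ R) h = stack-sorted h ∷ stack-sorted-all R (stack-tail h)

  HeadNonEmpty : List Floor → Set
  HeadNonEmpty []      = ⊤
  HeadNonEmpty (G ∷ R) = T (nonempty G)

  stack-headNonEmpty : ∀ {F} R → Stack F R → HeadNonEmpty R
  stack-headNonEmpty []      _ = tt
  stack-headNonEmpty (G ∷ R) h = stack-nonempty h

  supported-sound : ∀ {x} G F → T (supported k G F) → x ∈ G → T (hitsFloor x F)
  supported-sound (y ∷ G) F h (here refl) = ∧-fst {hitsFloor y F} h
  supported-sound (y ∷ G) F h (there m) = supported-sound G F (∧-snd {hitsFloor y F} h) m

  supported-complete : ∀ G F → (∀ {x} → x ∈ G → T (hitsFloor x F)) → T (supported k G F)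
  supported-complete [] F f = tt
  supported-complete (y ∷ G) F f = ∧-intro (f (here refl)) (supported-complete G F (λ m → f (there m)))

  stack-widen : ∀ {G G′} R → Stack G R → (∀ {y} → y ∈ G → y ∈ G′) → Stack G′ R
  stack-widen [] u f = stack tt
  stack-widen {G} {G′} (H ∷ R) u f =
    stack-cons (stack-nonempty u) (stack-sorted u) (supported-complete H G′ g) (stack-tail u)
    where
    g : ∀ {x} → x ∈ H → T (hitsFloor x G′)
    g m with hitsFloor-sound G (supported-sound H G (stack-supported u) m)
    ... | y , m′ , o = hitsFloor-complete G′ (f m′) o

  stack-remove : ∀ {p} G R → Stack G R → ¬ T (hits p R) → Stack (remove p G) R
  stack-remove G [] u c = stack tt
  stack-remove {p} G (H ∷ R) u c =
    stack-cons (stack-nonempty u) (stack-sorted u) (supported-complete H (remove p G) g) (stack-tail u)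
    where
    g : ∀ {x} → x ∈ H → T (hitsFloor x (remove p G))
    g {x} m with hitsFloor-sound G (supported-sound H G (stack-supported u) m)
    ... | y , m′ , o = hitsFloor-complete (remove p G) (∈-remove⁺ G m′ ne) o
      where
      ne : y ≢ p
      ne refl = c (hits-complete (H ∷ R) (here m) (overlap-sym o))

  stack-dropPiece : ∀ p F R → Stack F R → T (hitsFloor p F) ⊎ T (hits p R) →
            Σ (List Floor) λ R₂ → dropPiece p (F ∷ R) ≡ F ∷ R₂ × Stack F R₂
  stack-dropPiece p F R u c with hits p R in eq
  stack-dropPiece p F [] u c | true = ⊥-elim (true⇒T eq)
  stack-dropPiece p F (G ∷ R′) u c | true
    with stack-dropPiece p G R′ (stack-tail u) (∨-elim {hitsFloor p G} (true⇒T eq))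
  ... | R₂ , e , u′ rewrite e =
    G ∷ R₂ , refl , stack-cons (stack-nonempty u) (stack-sorted u) (stack-supported u) u′
  stack-dropPiece p F R u (inj₂ c) | false = ⊥-elim c
  stack-dropPiece p F [] u (inj₁ c) | false =
    (p ∷ []) ∷ [] , refl , stack-cons tt (sorted tt) (∧-intro c tt) (stack tt)
  stack-dropPiece p F (G ∷ R′) u (inj₁ c) | false =
    insert p G ∷ R′ , refl ,
    stack-cons (ne G) (sorted-insert G (stack-sorted u) (¬hits-head G R′ (false⇒¬T eq)))
               (supported-complete (insert p G) F g)
          (stack-widen R′ (stack-tail u) (∈-insert-old p G))
    where
    ne : ∀ G → T (nonempty (insert p G))
    ne [] = tt
    ne (x ∷ xs) with p <? x
    ... | yes _ = tt
    ... | no _ = tt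
    g : ∀ {x} → x ∈ insert p G → T (hitsFloor x F)
    g m with ∈-insert⁻ G m
    ... | inj₁ refl = c
    ... | inj₂ m′ = supported-sound G F (stack-supported u) m′

  AllNonEmpty : List Floor → Set
  AllNonEmpty R = All (λ G → T (nonempty G)) R

  stack-nonempty-all : ∀ {F} R → Stack F R → AllNonEmpty R
  stack-nonempty-all [] _ = []
  stack-nonempty-all (G ∷ R) u = stack-nonempty u ∷ stack-nonempty-all R (stack-tail u)

  maximal-exists : ∀ G R → AllNonEmpty (G ∷ R) → Σ ℤ λ y → Maximal y (G ∷ R)
  maximal-exists (x ∷ xs) [] (_ ∷ _) = x , inj₁ (here refl , λ ())
  maximal-exists G (H ∷ R) (_ ∷ ne) with maximal-exists H R ne
  ... | y , mx = y , inj₂ mx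

  leftmostMaximal-exists : ∀ G R → AllSorted (G ∷ R) → AllNonEmpty (G ∷ R) →
                           Σ ℤ λ p → leftmostMaximal (G ∷ R) ≡ just p
  leftmostMaximal-exists G R ss ne with maximal-exists G R ne
  ... | y , mx with leftmostMaximal-least (G ∷ R) ss mx
  ... | p , e , _ = p , e

  right-apart : ∀ {p y} → p < y + K → ¬ Overlap y p → p + K ≤ y
  right-apart {p} {y} lt n with ¬overlap⇒apart {y} {p} n
  ... | inj₁ h = ⊥-elim (<-irrefl refl (<-≤-trans lt h))
  ... | inj₂ h = h

  -- Suppose p < y + K for every maximal piece y of R.  If the maximal pieces
  -- of X are p and maximal pieces of R not overlapping p, then p is the
  -- leftmost maximal piece of X: those y lie at least K to its right.
  leftmost-new-piece : ∀ X R p → AllSorted X → Maximal p X →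
    (∀ y → Maximal y X → y ≡ p ⊎ (Maximal y R × ¬ Overlap y p)) →
    (∀ y → Maximal y R → p < y + K) → leftmostMaximal X ≡ just p
  leftmost-new-piece X R p ss p-max maximal-X left = leftmostMaximal-unique X ss p-max least
    where
    least : ∀ y → Maximal y X → p ≤ y
    least y mx with maximal-X y mx
    ... | inj₁ refl    = ≤-refl
    ... | inj₂ (m , n) = <⇒≤ (apart⇒< {p} (right-apart (left y m) n))

  leftmost-after-drop : ∀ p R → AllSorted R → (∀ y → Maximal y R → p < y + K) →
                        leftmostMaximal (dropPiece p R) ≡ just p
  leftmost-after-drop p R ss = leftmost-new-piece (dropPiece p R) R p (sorted-dropPiece p R ss)
                                 (maximal-dropPiece-new p R) (λ y → maximal-dropPiece R)

  leftmost-after-place : ∀ p R → AllSorted R → ¬ T (hits p R) → (∀ y → Maximal y R → p < y + K) →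
                         leftmostMaximal (placeOnTop p R) ≡ just p
  leftmost-after-place p R ss miss = leftmost-new-piece (placeOnTop p R) R p (sorted-placeOnTop p R ss miss)
                                       (maximal-placeOnTop-new p R miss) (λ y → maximal-placeOnTop R miss)

  preferUpper-new-piece : ∀ F R D p → (∀ a → a ∈ F → ¬ T (hits a D) → ¬ T (hits a R) × ¬ Overlap a p) →
    (∀ y → Maximal y (F ∷ R) → p < y + K) → preferUpper (firstFree F D) (just p) ≡ true
  preferUpper-new-piece F R D p free-F left with firstFree F D in e
  ... | nothing = refl
  ... | just a with firstFree-sound F D e
  ... | m , u with free-F a m u
  ... | u′ , n with p <? a
  ... | yes _ = refl
  ... | no q  = ⊥-elim (q (apart⇒< {p} (right-apart (left a (inj₁ (m , u′))) n)))

  free-after-drop : ∀ p R a → ¬ T (hits a (dropPiece p R)) → ¬ T (hits a R) × ¬ Overlap a p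
  free-after-drop p R a = free-in-sub R (dropPiece p R) (∈∈-dropPiece-old p R) (∈∈-dropPiece-new p R)

  free-after-place : ∀ p R a → ¬ T (hits a (placeOnTop p R)) → ¬ T (hits a R) × ¬ Overlap a p
  free-after-place p R a = free-in-sub R (placeOnTop p R) (∈∈-placeOnTop-old p R) (∈∈-placeOnTop-new p R)

  removeLM-floor : ∀ {p} G R → leftmostMaximal (G ∷ R) ≡ just p → ¬ T (hits p R) →
                   removeLM (G ∷ R) ≡ consNonEmpty (remove p G) R
  removeLM-floor {p} G R e c with preferUpper (firstFree G R) (leftmostMaximal R)
  ... | true = ⊥-elim (c (hits-complete R (maximal⇒∈∈ R (leftmostMaximal-sound R e)) (overlap-refl p)))
  ... | false rewrite e = refl

  removeLM-placeOnTop : ∀ p R → HeadNonEmpty R → ¬ T (hits p R) → leftmostMaximal (placeOnTop p R) ≡ just p →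
                        removeLM (placeOnTop p R) ≡ R
  removeLM-placeOnTop p [] u c e rewrite removeLM-floor (p ∷ []) [] e (λ ()) | remove-insert {p} [] (λ ()) = refl
  removeLM-placeOnTop p (G ∷ R) u c e
    rewrite removeLM-floor (insert p G) R e (¬hits-tail G R c)
          | remove-insert G (λ m → ¬hits-head G R c (hitsFloor-complete G m (overlap-refl p))) = keep G u
    where
    keep : ∀ G → T (nonempty G) → consNonEmpty G R ≡ G ∷ R
    keep (x ∷ xs) _ = refl

  removeLM-dropPiece : ∀ p F R → Stack F R → (∀ y → Maximal y (F ∷ R) → p < y + K) →
                       removeLM (dropPiece p (F ∷ R)) ≡ F ∷ R
  removeLM-dropPiece p F R u left with hits p R in eq
  removeLM-dropPiece p F [] u left | true = ⊥-elim (true⇒T eq)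
  removeLM-dropPiece p F (G ∷ R) u left | true
    rewrite leftmost-after-drop p (G ∷ R) (stack-sorted-all (G ∷ R) u) (λ y mx → left y (inj₂ mx))
          | preferUpper-new-piece F (G ∷ R) (dropPiece p (G ∷ R)) p (λ a _ → free-after-drop p (G ∷ R) a) left
    = cong (F ∷_) (removeLM-dropPiece p G R (stack-tail u) (λ y mx → left y (inj₂ mx)))
  removeLM-dropPiece p F R u left | false
    rewrite leftmost-after-place p R (stack-sorted-all R u) (false⇒¬T eq) (λ y mx → left y (inj₂ mx))
          | preferUpper-new-piece F R (placeOnTop p R) p (λ a _ → free-after-place p R a) left
    = cong (F ∷_) (removeLM-placeOnTop p R (stack-headNonEmpty R u) miss
                     (leftmost-after-place p R (stack-sorted-all R u) miss (λ y mx → left y (inj₂ mx))))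
    where
    miss : ¬ T (hits p R)
    miss = false⇒¬T eq

  ∈∈-consNonEmpty⁻ : ∀ {y} G R → y ∈∈ consNonEmpty G R → y ∈ G ⊎ y ∈∈ R
  ∈∈-consNonEmpty⁻ [] R m = inj₂ m
  ∈∈-consNonEmpty⁻ (x ∷ xs) R (here m) = inj₁ m
  ∈∈-consNonEmpty⁻ (x ∷ xs) R (there m) = inj₂ m

  ∈∈-consNonEmpty-floor : ∀ {y} G R → y ∈ G → y ∈∈ consNonEmpty G R
  ∈∈-consNonEmpty-floor (x ∷ xs) R m = here m

  ∈∈-consNonEmpty-rest : ∀ {y} G R → y ∈∈ R → y ∈∈ consNonEmpty G R
  ∈∈-consNonEmpty-rest [] R m = m
  ∈∈-consNonEmpty-rest (x ∷ xs) R m = there m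

  ∈∈-removeLM⁻ : ∀ {y} R → y ∈∈ removeLM R → y ∈∈ R
  ∈∈-removeLM⁻ (F ∷ R) m with firstFree F R
  ... | w with preferUpper w (leftmostMaximal R)
  ∈∈-removeLM⁻ (F ∷ R) (here m) | w | true = here m
  ∈∈-removeLM⁻ (F ∷ R) (there m) | w | true = there (∈∈-removeLM⁻ R m)
  ∈∈-removeLM⁻ (F ∷ R) m | nothing | false = m
  ∈∈-removeLM⁻ (F ∷ R) m | just a | false with ∈∈-consNonEmpty⁻ (remove a F) R m
  ... | inj₁ m′ = here (∈-remove⁻ F m′)
  ... | inj₂ m′ = there m′

  ∈∈-removeLM⁺ : ∀ {p y} R → leftmostMaximal R ≡ just p → y ∈∈ R → y ≡ p ⊎ y ∈∈ removeLM R
  ∈∈-removeLM⁺ {p} {y} (F ∷ R) e m with firstFree F R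
  ... | w with preferUpper w (leftmostMaximal R)
  ∈∈-removeLM⁺ {p} {y} (F ∷ R) e (here m) | w | true = inj₂ (here m)
  ∈∈-removeLM⁺ {p} {y} (F ∷ R) e (there m) | w | true with ∈∈-removeLM⁺ R e m
  ... | inj₁ x = inj₁ x
  ... | inj₂ x = inj₂ (there x)
  ∈∈-removeLM⁺ {p} {y} (F ∷ R) refl (here m) | just a | false with y ℤ.≟ a
  ... | yes eq = inj₁ eq
  ... | no ne = inj₂ (∈∈-consNonEmpty-floor (remove a F) R (∈-remove⁺ F m ne))
  ∈∈-removeLM⁺ {p} {y} (F ∷ R) refl (there m) | just a | false = inj₂ (∈∈-consNonEmpty-rest (remove a F) R m)

  -- If p was the leftmost maximal piece above F and weakly left of the free
  -- pieces of F, then once p is removed every free piece y of F satisfies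
  -- p < y + K: either y was free before (so p ≤ y), or it was hit only by p.
  free-bound : ∀ {p y} F R D → leftmostMaximal R ≡ just p → (∀ {x} → x ∈∈ R → x ≡ p ⊎ x ∈∈ D) →
           (∀ y → y ∈ F → ¬ T (hits y R) → p ≤ y) → y ∈ F → ¬ T (hits y D) → p < y + K
  free-bound {p} {y} F R D e sub H m u with hits y R in eq
  ... | false = ≤-<-trans (H y m (false⇒¬T eq)) (a<a+K y)
  ... | true with hits-sound R (true⇒T eq)
  ... | x , mx , o with sub mx
  ... | inj₁ refl = proj₁ o
  ... | inj₂ md = ⊥-elim (u (hits-complete D md o))

  remove-≢ : ∀ {p x} G → Sorted G → x ∈ remove p G → x ≢ p
  remove-≢ {p} (y ∷ ys) s m with p ℤ.≟ y
  remove-≢ {p} (y ∷ ys) s m | yes refl = λ e → <-irrefl (sym e) (apart⇒< {p} (sorted-all s m))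
  remove-≢ {p} (y ∷ ys) s (here refl) | no ne = λ e → ne (sym e)
  remove-≢ {p} (y ∷ ys) s (there m) | no ne = remove-≢ ys (sorted-tail s) m

  -- Floors standing on a single piece p that do not hit p are empty: the
  -- first of them would have to rest on p.
  nothing-above : ∀ {p} R → Stack (p ∷ []) R → ¬ T (hits p R) → R ≡ []
  nothing-above [] u c = refl
  nothing-above {p} ((h ∷ hs) ∷ R) u c
    with hitsFloor-sound (p ∷ []) (supported-sound (h ∷ hs) (p ∷ []) (stack-supported u) (here refl))
  ... | x , here refl , o = ⊥-elim (c (hits-complete ((h ∷ hs) ∷ R) (here (here refl)) (overlap-sym o)))

  DropRestores : ℤ → Floor → List Floor → List Floor → Set
  DropRestores p F R D =
    Stack F D × T (hits p (F ∷ D)) × (∀ y → Maximal y (F ∷ D) → p < y + K) × (dropPiece p (F ∷ D) ≡ F ∷ R)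

  restore-above : ∀ {p} F G R → Stack F (G ∷ R) → DropRestores p G R (removeLM R) →
    (∀ y → y ∈ F → ¬ T (hits y (G ∷ removeLM R)) → p < y + K) → DropRestores p F (G ∷ R) (G ∷ removeLM R)
  restore-above {p} F G R u (u₁ , hit , bound , restored) freeF =
    stack-cons (stack-nonempty u) (stack-sorted u) (stack-supported u) u₁ ,
    ∨-inr {hitsFloor p F} hit , bound′ , restored′
    where
    bound′ : ∀ y → Maximal y (F ∷ G ∷ removeLM R) → p < y + K
    bound′ y (inj₁ (m , c)) = freeF y m c
    bound′ y (inj₂ mx)      = bound y mx
    restored′ : dropPiece p (F ∷ G ∷ removeLM R) ≡ F ∷ G ∷ R
    restored′ rewrite T⇒true hit = cong (F ∷_) restored

  -- The removed piece p was the only piece of G; then G was the top floor.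
  restore-emptied : ∀ {p} F G R → Stack F (G ∷ R) → p ∈ G → ¬ T (hits p R) → remove p G ≡ [] →
    (∀ y → y ∈ F → ¬ T (hits y R) → p < y + K) → DropRestores p F (G ∷ R) R
  restore-emptied {p} F G R u p∈G free emptied freeF
    with nothing-above R (subst (λ g → Stack g R) (remove≡[] G p∈G emptied) (stack-tail u)) free
  ... | refl = stack tt , ∨-inl {hitsFloor p F} (supported-sound G F (stack-supported u) p∈G) , bound ,
               cong (λ g → F ∷ g ∷ []) (sym (remove≡[] G p∈G emptied))
    where
    bound : ∀ y → Maximal y (F ∷ []) → p < y + K
    bound y (inj₁ (m , c)) = freeF y m c

  restore-here : ∀ {p x xs} F G R → Stack F (G ∷ R) → p ∈ G → ¬ T (hits p R) → remove p G ≡ x ∷ xs →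
    (∀ y → y ∈ F → ¬ T (hits y ((x ∷ xs) ∷ R)) → p < y + K) → (∀ y → Maximal y (G ∷ R) → p ≤ y) →
    DropRestores p F (G ∷ R) ((x ∷ xs) ∷ R)
  restore-here {p} {x} {xs} F G R u p∈G free rest freeF leftmost =
    stack-cons tt (subst Sorted rest (sorted-remove G (stack-sorted u)))
      (supported-complete (x ∷ xs) F (λ m → supported-sound G F (stack-supported u) (in-G m)))
      (subst (λ g → Stack g R) rest (stack-remove G R (stack-tail u) free)) ,
    ∨-inl {hitsFloor p F} (supported-sound G F (stack-supported u) p∈G) , bound , restored
    where
    in-G : ∀ {y} → y ∈ x ∷ xs → y ∈ G
    in-G m = ∈-remove⁻ G (subst (_ ∈_) (sym rest) m)
    bound : ∀ y → Maximal y (F ∷ (x ∷ xs) ∷ R) → p < y + K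
    bound y (inj₁ (m , c))        = freeF y m c
    bound y (inj₂ (inj₁ (m , c))) = ≤-<-trans (leftmost y (inj₁ (in-G m , c))) (a<a+K y)
    bound y (inj₂ (inj₂ mx))      = ≤-<-trans (leftmost y (inj₂ mx)) (a<a+K y)
    -- p overlaps no remaining piece of G, since G is sorted
    misses : hits p ((x ∷ xs) ∷ R) ≡ false
    misses = ¬T⇒false λ h → [ misses-G , free ]′ (∨-elim {hitsFloor p (x ∷ xs)} h)
      where
      misses-G : ¬ T (hitsFloor p (x ∷ xs))
      misses-G h with hitsFloor-sound (x ∷ xs) h
      ... | y , y∈ , o = remove-≢ G (stack-sorted u) (subst (_ ∈_) (sym rest) y∈)
                           (sym (sorted-overlap⇒≡ (stack-sorted u) p∈G (in-G y∈) o))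
    restored : dropPiece p (F ∷ (x ∷ xs) ∷ R) ≡ F ∷ G ∷ R
    restored rewrite misses =
      cong (λ g → F ∷ g ∷ R) (trans (cong (insert p) (sym rest)) (insert-remove G (stack-sorted u) p∈G))

  dropPiece-removeLM : ∀ {p} F R → Stack F R → leftmostMaximal R ≡ just p →
    (∀ y → y ∈ F → ¬ T (hits y R) → p ≤ y) → DropRestores p F R (removeLM R)
  dropPiece-removeLM {p} F (G ∷ R) u e leftF =
    cases e (λ y m c → free-bound F (G ∷ R) (removeLM (G ∷ R)) e (∈∈-removeLM⁺ (G ∷ R) e) leftF m c)
          (λ y mx → leftmostMaximal-≤ (G ∷ R) (stack-sorted-all (G ∷ R) u) e mx)
    where
    cases : leftmostMaximal (G ∷ R) ≡ just p → (∀ y → y ∈ F → ¬ T (hits y (removeLM (G ∷ R))) → p < y + K) →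
            (∀ y → Maximal y (G ∷ R) → p ≤ y) → DropRestores p F (G ∷ R) (removeLM (G ∷ R))
    cases e′ freeF leftmost with firstFree G R in ff
    ... | w with preferUpper w (leftmostMaximal R)
    ... | true = restore-above F G R u
                   (dropPiece-removeLM G R (stack-tail u) e′ (λ y m c → leftmost y (inj₁ (m , c)))) freeF
    cases refl freeF leftmost | just p | false with firstFree-sound G R ff
    ... | p∈G , free with remove p G in rest
    ... | []     = restore-emptied F G R u p∈G free rest freeF
    ... | x ∷ xs = restore-here F G R u p∈G free rest freeF leftmost



-- After normalisation the bottom floor of a pyramid is the single
-- piece at the origin, so a pyramid is base ∷ R with R a stack above base.
-- Dropping a piece at c onto a pyramid gives a pyramid exactly when c hits
-- it; if moreover c < lm + K, where lm is the leftmost maximal piece, then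
-- c becomes the leftmost maximal piece and removeLM undoes the drop.
module Pyramids (j : ℕ) where
  open Floors j
  open TowerMoves j

  origin : ℤ
  origin = + 0

  base : Floor
  base = origin ∷ []

  IsPyramid : Tower → Set
  IsPyramid t = T (isPyramid k t)

  pyramid-view : ∀ t → IsPyramid t → Σ (List Floor) λ R → t ≡ base ∷ R × Stack base R
  pyramid-view ((a ∷ []) ∷ R) h with a ℤ.≟ origin
  ... | yes refl = R , refl , stack (∧-fst {upperFloorsOK k base R} h)
  ... | no _     = ⊥-elim h
  pyramid-view ((a ∷ b ∷ bs) ∷ R) h = ⊥-elim (∧-snd {isTower k ((a ∷ b ∷ bs) ∷ R)} h)

  pyramid-intro : ∀ R → Stack base R → IsPyramid (base ∷ R)
  pyramid-intro R (stack u) = ∧-intro {upperFloorsOK k base R} u tt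

  -- the one-piece pyramid, the root of both generating trees
  single : Tower
  single = base ∷ []

  single-unique : ∀ t → IsPyramid t → pieces t ≡ 1 → t ≡ single
  single-unique t g e with pyramid-view t g
  ... | []                , refl , u = refl
  ... | ((x ∷ xs) ∷ R) , refl , u with e
  ... | ()

  pieces-positive : ∀ t → IsPyramid t → 0 ℕ.< pieces t
  pieces-positive t g with pyramid-view t g
  ... | R , refl , u = ℕ.s≤s ℕ.z≤n

  hits-origin : ∀ G R → Stack base (G ∷ R) → T (hits origin (G ∷ R))
  hits-origin (x ∷ xs) R u with hitsFloor-sound base (supported-sound (x ∷ xs) base (stack-supported u) (here refl))
  ... | .origin , here refl , o = hits-complete ((x ∷ xs) ∷ R) (here (here refl)) (overlap-sym o)

  -- Hence the base piece is never maximal unless it is alone.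
  leftmostMaximal-base : ∀ G R → Stack base (G ∷ R) → leftmostMaximal (base ∷ G ∷ R) ≡ leftmostMaximal (G ∷ R)
  leftmostMaximal-base G R u with leftmostMaximal-exists G R (stack-sorted-all (G ∷ R) u) (stack-nonempty-all (G ∷ R) u)
  ... | p , e rewrite T⇒true (hits-origin G R u) | e = refl

  removeLM-base : ∀ G R → Stack base (G ∷ R) → removeLM (base ∷ G ∷ R) ≡ base ∷ removeLM (G ∷ R)
  removeLM-base G R u with leftmostMaximal-exists G R (stack-sorted-all (G ∷ R) u) (stack-nonempty-all (G ∷ R) u)
  ... | p , e rewrite T⇒true (hits-origin G R u) | e = refl

  Gapless : (ℤ → Set) → Set
  Gapless S = ∀ c a b → S a → a < c + K → S b → c < b + K → Σ ℤ λ x → S x × Overlap c x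

  gapless-cong : ∀ {S S′ : ℤ → Set} → (∀ {x} → S x → S′ x) → (∀ {x} → S′ x → S x) → Gapless S → Gapless S′
  gapless-cong f g C c a b sa la sb lb with C c a b (g sa) la (g sb) lb
  ... | x , sx , o = x , f sx , o

  gapless-add : ∀ {S : ℤ → Set} {y x₀} → Gapless S → S x₀ → Overlap y x₀ → Gapless (λ w → S w ⊎ w ≡ y)
  gapless-add C s₀ o₀ c a b (inj₁ sa) la (inj₁ sb) lb with C c a b sa la sb lb
  ... | x , sx , o = x , inj₁ sx , o
  gapless-add {y = y} C s₀ o₀ c a b (inj₂ refl) la (inj₂ refl) lb = y , inj₂ refl , la , lb
  gapless-add {y = y} {x₀} C s₀ o₀ c a b (inj₂ refl) la (inj₁ sb) lb with c <? y + K
  ... | yes lt = y , inj₂ refl , la , lt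
  ... | no nlt with C c x₀ b s₀ (<-trans (proj₁ o₀) (≤-<-trans (≮⇒≥ nlt) (a<a+K c))) sb lb
  ... | x , sx , o = x , inj₁ sx , o
  gapless-add {y = y} {x₀} C s₀ o₀ c a b (inj₁ sa) la (inj₂ refl) lb with y <? c + K
  ... | yes lt = y , inj₂ refl , lt , lb
  ... | no nlt with C c a x₀ sa la s₀ (≤-<-trans (≤-trans (a≤a+K c) (≮⇒≥ nlt)) (proj₂ o₀))
  ... | x , sx , o = x , inj₁ sx , o

  gapless-floor : ∀ {S : ℤ → Set} F G → Gapless S → (∀ {x} → x ∈ F → S x) → T (supported k G F) →
                  Gapless (λ w → S w ⊎ w ∈ G)
  gapless-floor F [] C f s = gapless-cong inj₁ [ (λ a → a) , (λ ()) ]′ C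
  gapless-floor {S} F (y ∷ G) C f s with hitsFloor-sound F (supported-sound (y ∷ G) F s (here refl))
  ... | x₀ , m₀ , o₀ =
    gapless-cong to from (gapless-add (gapless-floor F G C f (∧-snd {hitsFloor y F} s)) (inj₁ (f m₀)) o₀)
    where
    to : ∀ {x} → (S x ⊎ x ∈ G) ⊎ x ≡ y → S x ⊎ x ∈ y ∷ G
    to (inj₁ (inj₁ a)) = inj₁ a
    to (inj₁ (inj₂ a)) = inj₂ (there a)
    to (inj₂ refl)     = inj₂ (here refl)
    from : ∀ {x} → S x ⊎ x ∈ y ∷ G → (S x ⊎ x ∈ G) ⊎ x ≡ y
    from (inj₁ a)          = inj₁ (inj₁ a)
    from (inj₂ (here refl)) = inj₂ refl
    from (inj₂ (there a))  = inj₁ (inj₂ a)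

  gapless-stack : ∀ {S : ℤ → Set} F R → Gapless S → (∀ {x} → x ∈ F → S x) → Stack F R →
                  Gapless (λ w → S w ⊎ w ∈∈ R)
  gapless-stack F [] C f u = gapless-cong inj₁ [ (λ a → a) , (λ ()) ]′ C
  gapless-stack {S} F (G ∷ R) C f u =
    gapless-cong to from (gapless-stack G R (gapless-floor F G C f (stack-supported u)) inj₂ (stack-tail u))
    where
    to : ∀ {x} → (S x ⊎ x ∈ G) ⊎ x ∈∈ R → S x ⊎ x ∈∈ (G ∷ R)
    to (inj₁ (inj₁ a)) = inj₁ a
    to (inj₁ (inj₂ a)) = inj₂ (here a)
    to (inj₂ a)        = inj₂ (there a)
    from : ∀ {x} → S x ⊎ x ∈∈ (G ∷ R) → (S x ⊎ x ∈ G) ⊎ x ∈∈ R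
    from (inj₁ a)         = inj₁ (inj₁ a)
    from (inj₂ (here a))  = inj₁ (inj₂ a)
    from (inj₂ (there a)) = inj₂ a

  gapless-base : Gapless (_∈ base)
  gapless-base c a b (here refl) la (here refl) lb = origin , here refl , la , lb

  pyramid-gapless : ∀ R → Stack base R → ∀ {c a b} → a ∈∈ (base ∷ R) → a < c + K → b ∈∈ (base ∷ R) → c < b + K →
                    T (hits c (base ∷ R))
  pyramid-gapless R u {c} {a} {b} ma la mb lb
    with gapless-stack base R gapless-base (λ m → m) u c a b (split ma) la (split mb) lb
    where
    split : ∀ {x} → x ∈∈ (base ∷ R) → x ∈ base ⊎ x ∈∈ R
    split (here m)  = inj₁ m
    split (there m) = inj₂ m
  ... | x , inj₁ m , o = hits-complete (base ∷ R) (here m) o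
  ... | x , inj₂ m , o = hits-complete (base ∷ R) (there m) o

  -- The left edge of a tower: its leftmost piece (origin for no pieces).
  minFloor : Floor → ℤ → ℤ
  minFloor []       a = a
  minFloor (x ∷ xs) a = x ⊓ minFloor xs a

  leftEdge : Tower → ℤ
  leftEdge []      = origin
  leftEdge (F ∷ R) = minFloor F (leftEdge R)

  minFloor-≤-default : ∀ F a → minFloor F a ≤ a
  minFloor-≤-default []      a = ≤-refl
  minFloor-≤-default (x ∷ F) a = ≤-trans (i⊓j≤j x _) (minFloor-≤-default F a)

  minFloor-≤ : ∀ {y} F a → y ∈ F → minFloor F a ≤ y
  minFloor-≤ (x ∷ F) a (here refl) = i⊓j≤i x _
  minFloor-≤ (x ∷ F) a (there m)   = ≤-trans (i⊓j≤j x _) (minFloor-≤ F a m)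

  minFloor-sel : ∀ F a → minFloor F a ≡ a ⊎ minFloor F a ∈ F
  minFloor-sel []      a = inj₁ refl
  minFloor-sel (x ∷ F) a with ⊓-sel x (minFloor F a)
  ... | inj₁ e = inj₂ (subst (_∈ x ∷ F) (sym e) (here refl))
  ... | inj₂ e with minFloor-sel F a
  ... | inj₁ e′ = inj₁ (trans e e′)
  ... | inj₂ m  = inj₂ (subst (_∈ x ∷ F) (sym e) (there m))

  leftEdge-≤ : ∀ {y} t → y ∈∈ t → leftEdge t ≤ y
  leftEdge-≤ (F ∷ R) (here m)  = minFloor-≤ F (leftEdge R) m
  leftEdge-≤ (F ∷ R) (there m) = ≤-trans (minFloor-≤-default F (leftEdge R)) (leftEdge-≤ R m)

  leftEdge-sel : ∀ t → leftEdge t ≡ origin ⊎ leftEdge t ∈∈ t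
  leftEdge-sel [] = inj₁ refl
  leftEdge-sel (F ∷ R) with minFloor-sel F (leftEdge R)
  ... | inj₂ m = inj₂ (here m)
  ... | inj₁ e with leftEdge-sel R
  ... | inj₁ e′ = inj₁ (trans e e′)
  ... | inj₂ m  = inj₂ (there (subst (_∈∈ R) (sym e) m))

  leftEdge-∈ : ∀ t → origin ∈∈ t → leftEdge t ∈∈ t
  leftEdge-∈ t o∈ with leftEdge-sel t
  ... | inj₁ e = subst (_∈∈ t) (sym e) o∈
  ... | inj₂ m = m

  leftEdge-unique : ∀ {m} t → origin ∈∈ t → m ∈∈ t → (∀ {x} → x ∈∈ t → m ≤ x) → leftEdge t ≡ m
  leftEdge-unique t o∈ m∈ least = ≤-antisym (leftEdge-≤ t m∈) (least (leftEdge-∈ t o∈))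

  leftEdge-dropPiece : ∀ c t → origin ∈∈ t → leftEdge (dropPiece c t) ≡ c ⊓ leftEdge t
  leftEdge-dropPiece c t o∈ = leftEdge-unique (dropPiece c t) (∈∈-dropPiece-old c t o∈) member least
    where
    member : c ⊓ leftEdge t ∈∈ dropPiece c t
    member with ⊓-sel c (leftEdge t)
    ... | inj₁ e = subst (_∈∈ dropPiece c t) (sym e) (∈∈-dropPiece-new c t)
    ... | inj₂ e = subst (_∈∈ dropPiece c t) (sym e) (∈∈-dropPiece-old c t (leftEdge-∈ t o∈))
    least : ∀ {x} → x ∈∈ dropPiece c t → c ⊓ leftEdge t ≤ x
    least m with ∈∈-dropPiece⁻ t m
    ... | inj₁ refl = i⊓j≤i c (leftEdge t)
    ... | inj₂ m′   = ≤-trans (i⊓j≤j c (leftEdge t)) (leftEdge-≤ t m′)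

  origin∈ : ∀ R → origin ∈∈ (base ∷ R)
  origin∈ R = here (here refl)

  fromJust : Maybe ℤ → ℤ
  fromJust (just p) = p
  fromJust nothing  = origin

  lmPos : Tower → ℤ
  lmPos t = fromJust (leftmostMaximal t)

  leftmostMaximal-pyramid : ∀ R → Stack base R → leftmostMaximal (base ∷ R) ≡ just (lmPos (base ∷ R))
  leftmostMaximal-pyramid R u
    with leftmostMaximal-exists base R (sorted tt ∷ stack-sorted-all R u) (tt ∷ stack-nonempty-all R u)
  ... | p , e rewrite e = refl

  lmPos∈ : ∀ R → Stack base R → lmPos (base ∷ R) ∈∈ (base ∷ R)
  lmPos∈ R u = maximal⇒∈∈ (base ∷ R) (leftmostMaximal-sound (base ∷ R) (leftmostMaximal-pyramid R u))

  leftEdge≤lmPos : ∀ R → Stack base R → leftEdge (base ∷ R) ≤ lmPos (base ∷ R)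
  leftEdge≤lmPos R u = leftEdge-≤ (base ∷ R) (lmPos∈ R u)

  Dropped : ℤ → Tower → Set
  Dropped c t = Σ (List Floor) λ R₂ → dropPiece c t ≡ base ∷ R₂ × Stack base R₂ ×
    removeLM (dropPiece c t) ≡ t × lmPos (dropPiece c t) ≡ c × pieces (dropPiece c t) ≡ suc (pieces t)

  dropPiece-pyramid : ∀ c R → Stack base R → T (hits c (base ∷ R)) → c < lmPos (base ∷ R) + K → Dropped c (base ∷ R)
  dropPiece-pyramid c R u hit c<lm+K with stack-dropPiece c base R u (∨-elim {hitsFloor c base} hit)
  ... | R₂ , e , u₂ = R₂ , e , u₂ , removeLM-dropPiece c base R u left ,
        cong fromJust (leftmost-after-drop c t ss left) ,
        pieces-dropPiece c t
    where
    t = base ∷ R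
    ss : AllSorted t
    ss = sorted tt ∷ stack-sorted-all R u
    left : ∀ y → Maximal y t → c < y + K
    left y mx = <-≤-trans c<lm+K (+-monoˡ-≤ K (leftmostMaximal-≤ t ss (leftmostMaximal-pyramid R u) mx))

  Undroppable : ℤ → Tower → Set
  Undroppable q s = Σ (List Floor) λ R₂ → removeLM s ≡ base ∷ R₂ × Stack base R₂ ×
    T (hits q (base ∷ R₂)) × q < lmPos (base ∷ R₂) + K × dropPiece q (base ∷ R₂) ≡ s

  removeLM-pyramid : ∀ G R → Stack base (G ∷ R) → Undroppable (lmPos (base ∷ G ∷ R)) (base ∷ G ∷ R)
  removeLM-pyramid G R u
    with leftmostMaximal-exists G R (stack-sorted-all (G ∷ R) u) (stack-nonempty-all (G ∷ R) u)
  ... | p , e = subst (λ q → Undroppable q (base ∷ G ∷ R))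
                      (sym (cong fromJust (trans (leftmostMaximal-base G R u) e)))
                      (repack (dropPiece-removeLM base (G ∷ R) u e base-free))
    where
    base-free : ∀ y → y ∈ base → ¬ T (hits y (G ∷ R)) → p ≤ y
    base-free y (here refl) c = ⊥-elim (c (hits-origin G R u))
    D = removeLM (G ∷ R)
    repack : DropRestores p base (G ∷ R) D → Undroppable p (base ∷ G ∷ R)
    repack (u₂ , hit , left , restored) =
      D , removeLM-base G R u , u₂ , hit ,
      left (lmPos (base ∷ D)) (leftmostMaximal-sound (base ∷ D) (leftmostMaximal-pyramid D u₂)) , restored

-- Label a pyramid by u = lm - e, where
-- lm is its leftmost maximal piece and e its left edge.  Its children are
-- obtained by dropping a piece at e - (k - 1) + i for i < u + 2k - 1,
-- i.e. at every c with e - K < c < lm + K; all these positions hit the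
-- pyramid (it is gapless), the new piece becomes the leftmost maximal one,
-- and the child's label is c - min(c, e) = i ∸ (k - 1).  Conversely
-- removeLM recovers the parent and the index of the child.
module PyramidTree (j : ℕ) where
  open Floors j
  open TowerMoves j
  open Pyramids j
  open TreeCounts j using (pyramidArity; pyramidChildLabel; pyramidTreeCount)
  open GeneratingTrees using (module GeneratingTree)

  Jℤ : ℤ
  Jℤ = + j

  pyramidLabel : Tower → ℕ
  pyramidLabel t = ∣ lmPos t - leftEdge t ∣

  dropPosition : Tower → ℕ → ℤ
  dropPosition t i = (leftEdge t - Jℤ) + + i

  pyramidChild : Tower → ℕ → Tower
  pyramidChild t i = dropPiece (dropPosition t i) t

  pyramidChildIndex : Tower → ℕ
  pyramidChildIndex s = ∣ lmPos s - (leftEdge (removeLM s) - Jℤ) ∣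

  +ℕ-cancel-< : ∀ β (i n : ℕ) → β + + i < β + + n → i ℕ.< n
  +ℕ-cancel-< β i n h = drop‿+<+ (+-cancelʳ-< β (subst₂ _<_ (+-comm β (+ i)) (+-comm β (+ n)) h))

  +ℕ-cancel-≤ : ∀ β (i n : ℕ) → β + + i ≤ β + + n → i ℕ.≤ n
  +ℕ-cancel-≤ β i n h = drop‿+≤+ (+-cancelʳ-≤ β (subst₂ _≤_ (+-comm β (+ i)) (+-comm β (+ n)) h))

  0≤- : ∀ {a b} → a ≤ b → + 0 ≤ b - a
  0≤- {a} {b} h = subst (_≤ b - a) (+-inverseʳ a) (+-monoˡ-≤ (- a) h)

  window-end : ∀ R → Stack base R →
    lmPos (base ∷ R) + K ≡ (leftEdge (base ∷ R) - Jℤ) + + pyramidArity (pyramidLabel (base ∷ R))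
  window-end R u = trans (split lm e K Jℤ)
                         (cong (λ x → (e - Jℤ) + (x + (K + Jℤ))) (sym (0≤i⇒+∣i∣≡i (0≤- (leftEdge≤lmPos R u)))))
    where
    lm = lmPos (base ∷ R)
    e = leftEdge (base ∷ R)
    split : ∀ lm e K J → lm + K ≡ (e - J) + ((lm - e) + (K + J))
    split = solve-∀

  PyramidChildSpec : Tower → ℕ → Set
  PyramidChildSpec t i =
    IsPyramid (pyramidChild t i) × removeLM (pyramidChild t i) ≡ t × pieces (pyramidChild t i) ≡ suc (pieces t)
      × pyramidChildIndex (pyramidChild t i) ≡ i × pyramidLabel (pyramidChild t i) ≡ i ∸ j

  pyramid-child-spec′ : ∀ R i → Stack base R → i ℕ.< pyramidArity (pyramidLabel (base ∷ R)) →
                        PyramidChildSpec (base ∷ R) i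
  pyramid-child-spec′ R i u i<arity = spec (dropPiece-pyramid c R u hit c<lm+K)
    where
    t = base ∷ R
    e = leftEdge t
    β = e - Jℤ
    c = β + + i
    c<lm+K : c < lmPos t + K
    c<lm+K = subst (c <_) (sym (window-end R u)) (+-monoʳ-< β (ℤ.+<+ i<arity))
    e<c+K : e < c + K
    e<c+K = subst (e <_) (sym (shift e (+ i) Jℤ))
              (subst (_< e + + suc i) (+-identityʳ e) (+-monoʳ-< e (ℤ.+<+ ℕ.z<s)))
      where
      shift : ∀ e i J → (e - J) + i + (ℤ.1ℤ + J) ≡ e + (ℤ.1ℤ + i)
      shift = solve-∀
    hit : T (hits c t)
    hit = pyramid-gapless R u (leftEdge-∈ t (origin∈ R)) e<c+K (lmPos∈ R u) c<lm+K
    new-label : ∣ c - c ⊓ e ∣ ≡ i ∸ j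
    new-label with c ≤? e
    ... | yes c≤e = begin
      ∣ c - c ⊓ e ∣  ≡⟨ cong (λ x → ∣ c - x ∣) (i≤j⇒i⊓j≡i c≤e) ⟩
      ∣ c - c ∣      ≡⟨ cong ∣_∣ (+-inverseʳ c) ⟩
      0              ≡⟨ sym (ℕP.m≤n⇒m∸n≡0 (+ℕ-cancel-≤ β i j (subst (c ≤_) (sym (minus-plus e Jℤ)) c≤e))) ⟩
      i ∸ j          ∎
      where open ≡-Reasoning
    ... | no c≰e = begin
      ∣ c - c ⊓ e ∣  ≡⟨ cong (λ x → ∣ c - x ∣) (i≥j⇒i⊓j≡j (<⇒≤ (≰⇒> c≰e))) ⟩
      ∣ c - e ∣      ≡⟨ cong ∣_∣ (trans (shifted e (+ i) Jℤ) (m-n≡m⊖n i j)) ⟩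
      ∣ i ⊖ j ∣      ≡⟨ cong ∣_∣ (⊖-≥ j≤i) ⟩
      i ∸ j          ∎
      where
      open ≡-Reasoning
      shifted : ∀ e i J → ((e - J) + i) - e ≡ i - J
      shifted = solve-∀
      j≤i : j ℕ.≤ i
      j≤i = ℕP.<⇒≤ (+ℕ-cancel-< β j i (subst (_< c) (sym (minus-plus e Jℤ)) (≰⇒> c≰e)))
    spec : Dropped c t → PyramidChildSpec t i
    spec (R₂ , e₂ , u₂ , restored , lm-c , size) =
      subst IsPyramid (sym e₂) (pyramid-intro R₂ u₂) , restored , size ,
      trans (cong₂ (λ a b → ∣ a - (leftEdge b - Jℤ) ∣) lm-c restored) (cong ∣_∣ (cancel β (+ i))) ,
      trans (cong₂ (λ a b → ∣ a - b ∣) lm-c (leftEdge-dropPiece c t (origin∈ R))) new-label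
      where
      cancel : ∀ b i → (b + i) - b ≡ i
      cancel = solve-∀

  pyramid-child-spec : ∀ t i → IsPyramid t → i ℕ.< pyramidArity (pyramidLabel t) → PyramidChildSpec t i
  pyramid-child-spec t i g i<arity with pyramid-view t g
  ... | R , refl , u = pyramid-child-spec′ R i u i<arity

  PyramidParentSpec : Tower → Set
  PyramidParentSpec s =
    IsPyramid (removeLM s) × pyramidChildIndex s ℕ.< pyramidArity (pyramidLabel (removeLM s))
      × pyramidChild (removeLM s) (pyramidChildIndex s) ≡ s

  pyramid-parent-spec′ : ∀ G R → Stack base (G ∷ R) → PyramidParentSpec (base ∷ G ∷ R)
  pyramid-parent-spec′ G R u with removeLM-pyramid G R u
  ... | R₂ , removed , u₂ , hit , p<lm+K , restored =
    subst (λ d → IsPyramid d × ∣ p - (leftEdge d - Jℤ) ∣ ℕ.< pyramidArity (pyramidLabel d)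
                 × dropPiece ((leftEdge d - Jℤ) + + ∣ p - (leftEdge d - Jℤ) ∣) d ≡ s) (sym removed)
          (pyramid-intro R₂ u₂ , index<arity , trans (cong (λ x → dropPiece x t) position) restored)
    where
    s = base ∷ G ∷ R
    p = lmPos s
    t = base ∷ R₂
    e = leftEdge t
    β = e - Jℤ
    e<p+K : e < p + K
    e<p+K with hits-sound t hit
    ... | x , x∈ , o = ≤-<-trans (leftEdge-≤ t x∈) (proj₁ o)
    β≤p : β ≤ p
    β≤p = +-cancelʳ-≤ ℤ.1ℤ (subst (_≤ p + ℤ.1ℤ) (+-comm ℤ.1ℤ β)
            (i<j⇒suc[i]≤j {β} (+-cancelʳ-< {β} Jℤ (subst₂ _<_ (sym (minus-plus e Jℤ)) (regroup p Jℤ) e<p+K))))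
      where
      regroup : ∀ p J → p + (ℤ.1ℤ + J) ≡ (p + ℤ.1ℤ) + J
      regroup = solve-∀
    position : β + + ∣ p - β ∣ ≡ p
    position = trans (cong (λ x → β + x) (0≤i⇒+∣i∣≡i (0≤- β≤p))) (cancel β p)
      where
      cancel : ∀ b p → b + (p - b) ≡ p
      cancel = solve-∀
    index<arity : ∣ p - β ∣ ℕ.< pyramidArity (pyramidLabel t)
    index<arity = +ℕ-cancel-< β _ _ (subst₂ _<_ (sym position) (window-end R₂ u₂) p<lm+K)

  pyramid-parent-spec : ∀ s → IsPyramid s → 1 ℕ.< pieces s → PyramidParentSpec s
  pyramid-parent-spec s g big with pyramid-view s g
  ... | []      , refl , u = ⊥-elim (ℕP.<-irrefl refl big)
  ... | (G ∷ R) , refl , u = pyramid-parent-spec′ G R u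

  module Tree = GeneratingTree (isPyramid k) pieces pyramidLabel pyramidArity pyramidChildLabel
    pyramidChild removeLM pyramidChildIndex single tt refl single-unique pieces-positive
    pyramid-child-spec pyramid-parent-spec

  pyramids↔Fin : ∀ m → Pyramid k (suc m) ↔ Fin (pyramidTreeCount m 0)
  pyramids↔Fin = Tree.sized↔Fin

-- Label a half-pyramid by its leftmost maximal piece lm ≥ 0; its
-- children drop a piece at each i with 0 ≤ i < lm + K, which hits the
-- pyramid (as 0 < i + K) and becomes the new leftmost maximal piece.
module HalfPyramidTree (j : ℕ) where
  open Floors j
  open TowerMoves j
  open Pyramids j
  open TreeCounts j using (halfArity; halfChildLabel; halfTreeCount)
  open GeneratingTrees using (module GeneratingTree)

  IsHalfPyramid : Tower → Set
  IsHalfPyramid t = T (isHalfPyramid k t)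

  RightOfOrigin : Tower → Set
  RightOfOrigin t = ∀ {y} → y ∈∈ t → origin ≤ y

  rightOfOriginᵇ : Floor → Bool
  rightOfOriginᵇ F = all (λ a → ⌊ + 0 ≤? a ⌋) F

  rightOfOrigin-floor-sound : ∀ F → T (rightOfOriginᵇ F) → ∀ {y} → y ∈ F → origin ≤ y
  rightOfOrigin-floor-sound (x ∷ F) h (here refl) = toWitness (∧-fst {⌊ + 0 ≤? x ⌋} h)
  rightOfOrigin-floor-sound (x ∷ F) h (there m)   = rightOfOrigin-floor-sound F (∧-snd {⌊ + 0 ≤? x ⌋} h) m

  rightOfOrigin-floor-complete : ∀ F → (∀ {y} → y ∈ F → origin ≤ y) → T (rightOfOriginᵇ F)
  rightOfOrigin-floor-complete []      f = tt
  rightOfOrigin-floor-complete (x ∷ F) f =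
    ∧-intro (fromWitness (f (here refl))) (rightOfOrigin-floor-complete F (λ m → f (there m)))

  rightOfOrigin-sound : ∀ t → T (all rightOfOriginᵇ t) → RightOfOrigin t
  rightOfOrigin-sound (F ∷ t) h (here m)  = rightOfOrigin-floor-sound F (∧-fst {rightOfOriginᵇ F} h) m
  rightOfOrigin-sound (F ∷ t) h (there m) = rightOfOrigin-sound t (∧-snd {rightOfOriginᵇ F} h) m

  rightOfOrigin-complete : ∀ t → RightOfOrigin t → T (all rightOfOriginᵇ t)
  rightOfOrigin-complete []      f = tt
  rightOfOrigin-complete (F ∷ t) f =
    ∧-intro (rightOfOrigin-floor-complete F (λ m → f (here m))) (rightOfOrigin-complete t (λ m → f (there m)))

  halfPyramid-view : ∀ t → IsHalfPyramid t → IsPyramid t × RightOfOrigin t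
  halfPyramid-view t h = ∧-fst {isPyramid k t} h , rightOfOrigin-sound t (∧-snd {isPyramid k t} h)

  halfPyramid-intro : ∀ t → IsPyramid t → RightOfOrigin t → IsHalfPyramid t
  halfPyramid-intro t g r = ∧-intro g (rightOfOrigin-complete t r)

  halfLabel : Tower → ℕ
  halfLabel t = ∣ lmPos t ∣

  halfChild : Tower → ℕ → Tower
  halfChild t i = dropPiece (+ i) t

  halfChildIndex : Tower → ℕ
  halfChildIndex s = ∣ lmPos s ∣

  ∣∣-<-+K : ∀ {a b : ℤ} → + 0 ≤ a → + 0 ≤ b → a < b + K → ∣ a ∣ ℕ.< ∣ b ∣ ℕ.+ k
  ∣∣-<-+K {+ a} {+ b} _ _ h = drop‿+<+ h

  HalfChildSpec : Tower → ℕ → Set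
  HalfChildSpec t i =
    IsHalfPyramid (halfChild t i) × removeLM (halfChild t i) ≡ t × pieces (halfChild t i) ≡ suc (pieces t)
      × halfChildIndex (halfChild t i) ≡ i × halfLabel (halfChild t i) ≡ i

  half-child-spec′ : ∀ R i → Stack base R → RightOfOrigin (base ∷ R) → i ℕ.< halfArity (halfLabel (base ∷ R)) →
                     HalfChildSpec (base ∷ R) i
  half-child-spec′ R i u right i<arity = spec (dropPiece-pyramid c R u hit c<lm+K)
    where
    t = base ∷ R
    c = + i
    c<lm+K : c < lmPos t + K
    c<lm+K = window (lmPos t) (right (lmPos∈ R u)) i<arity
      where
      window : ∀ l → + 0 ≤ l → i ℕ.< ∣ l ∣ ℕ.+ k → c < l + K
      window (+ l) _ h = ℤ.+<+ h
    hit : T (hits c t)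
    hit = pyramid-gapless R u (origin∈ R) (ℤ.+<+ (ℕP.<-≤-trans ℕ.z<s (ℕP.m≤n+m k i))) (lmPos∈ R u) c<lm+K
    spec : Dropped c t → HalfChildSpec t i
    spec (R₂ , e , u₂ , restored , lm-c , size) =
      halfPyramid-intro (dropPiece c t) (subst IsPyramid (sym e) (pyramid-intro R₂ u₂)) right′ ,
      restored , size , cong ∣_∣ lm-c , cong ∣_∣ lm-c
      where
      right′ : RightOfOrigin (dropPiece c t)
      right′ m with ∈∈-dropPiece⁻ t m
      ... | inj₁ refl = ℤ.+≤+ ℕ.z≤n
      ... | inj₂ m′   = right m′

  half-child-spec : ∀ t i → T (isHalfPyramid k t) → i ℕ.< halfArity (halfLabel t) → HalfChildSpec t i
  half-child-spec t i h i<arity with halfPyramid-view t h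
  ... | g , right with pyramid-view t g
  ... | R , refl , u = half-child-spec′ R i u right i<arity

  HalfParentSpec : Tower → Set
  HalfParentSpec s =
    IsHalfPyramid (removeLM s) × halfChildIndex s ℕ.< halfArity (halfLabel (removeLM s))
      × halfChild (removeLM s) (halfChildIndex s) ≡ s

  half-parent-spec′ : ∀ G R → Stack base (G ∷ R) → RightOfOrigin (base ∷ G ∷ R) → HalfParentSpec (base ∷ G ∷ R)
  half-parent-spec′ G R u right with removeLM-pyramid G R u
  ... | R₂ , removed , u₂ , hit , p<lm+K , restored =
    subst (λ d → IsHalfPyramid d × ∣ p ∣ ℕ.< halfArity (halfLabel d) × dropPiece (+ ∣ p ∣) d ≡ s) (sym removed)
          (halfPyramid-intro t (pyramid-intro R₂ u₂) right′ , index<arity ,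
           trans (cong (λ x → dropPiece x t) (0≤i⇒+∣i∣≡i 0≤p)) restored)
    where
    s = base ∷ G ∷ R
    p = lmPos s
    t = base ∷ R₂
    0≤p : + 0 ≤ p
    0≤p = right (lmPos∈ (G ∷ R) u)
    right′ : RightOfOrigin t
    right′ m = right (∈∈-removeLM⁻ s (subst (_ ∈∈_) (sym removed) m))
    index<arity : ∣ p ∣ ℕ.< halfArity (halfLabel t)
    index<arity = ∣∣-<-+K 0≤p (right′ (lmPos∈ R₂ u₂)) p<lm+K

  half-parent-spec : ∀ s → T (isHalfPyramid k s) → 1 ℕ.< pieces s → HalfParentSpec s
  half-parent-spec s h big with halfPyramid-view s h
  ... | g , right with pyramid-view s g
  ... | []      , refl , u = ⊥-elim (ℕP.<-irrefl refl big)
  ... | (G ∷ R) , refl , u = half-parent-spec′ G R u right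

  module Tree = GeneratingTree (isHalfPyramid k) pieces halfLabel halfArity halfChildLabel
    halfChild removeLM halfChildIndex single tt refl
    (λ t h → single-unique t (proj₁ (halfPyramid-view t h)))
    (λ t h → pieces-positive t (proj₁ (halfPyramid-view t h)))
    half-child-spec half-parent-spec

  halfPyramids↔Fin : ∀ m → HalfPyramid k (suc m) ↔ Fin (halfTreeCount m 0)
  halfPyramids↔Fin = Tree.sized↔Fin

open FiniteSums using (Fin-cong)

mainTheorem2 : (k : ℕ) → .{{ _ : NonZero k }} → (n : ℕ) → n ≥ 1 →
    (HalfPyramid k n ↔ Fin (halfPyramidCount k n))
    × (Pyramid k n ↔ Fin (pyramidCount k n))
mainTheorem2 (suc j) (suc m) _ =
  ↔-trans (HalfPyramidTree.halfPyramids↔Fin j m) (Fin-cong (TreeCounts.halfTree-total j m)) ,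
  ↔-trans (PyramidTree.pyramids↔Fin j m) (Fin-cong (TreeCounts.pyramidTree-total j m))
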